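{- Let $n\ge 3$ be odd, let $B,C$ be nonzero integers, and let $p$ be a prime. Write $B=p^kB'$ and $C=p^\ell C'$ with $k,\ell\ge 0$ and $p\nmid B'C'$. Then $\mathcal{Y}_{B,C}(\mathbb{Z}_p)=\emptyset$ if and only if $\ell$ is odd and one of the following holds: (i) $k$ is odd and $\ell<k<n+\ell$; (ii) $p\neq 2$, $k$ is even, $k<n+\ell$, and the Legendre symbol $\left(\frac{ -B'}{p}\right)=-1$; (iii) $p=2$, $k$ is even, $k<\ell$, and $B'\equiv 3\pmod 8$; (iv) $p=2$, $k$ is even, $\ell<k<n+\ell-2$, and $B'\equiv 1,3,5\pmod 8$; (v) $p=2$, $k=n+\ell-2$, and $B'\equiv 1,5\pmod 8$.
   Context: For nonzero integers $B,C$ and odd $n\ge3$, $\mathcal{Y}_{B,C}$ is the quotient stack $[S/\mathbb{G}_m]$ with $S=\operatorname{Spec}\mathbb{Z}[x,y,z]/(x^2+By^2-Cz^n)\smallsetminus\{x=y=z=0\}$ and $\lambda\in\mathbb{G}_m$ acting by $(x,y,z)\mapsto(\lambda^nx,\lambda^ny,\lambda^2z)$. For a principal ideal domain $R$, the objects of the groupoid $\mathcal{Y}_{B,C}(R)$ are the primitive triples $(x,y,z)\in R^3$ (no prime element of $R$ divides all three) with $x^2+By^2=Cz^n$, written $[x:y:z]$, and morphisms are units $\lambda\in R^\times$ with $(x',y',z')=(\lambda^nx,\lambda^ny,\lambda^2z)$. Thus $\mathcal{Y}_{B,C}(\mathbb{Z}_p)\neq\emptyset$ means there is a primitive solution in $\mathbb{Z}_p^3$.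 -}

module Defs where

open import Data.Nat as ℕ using (ℕ; suc; _^_)
open import Data.Nat.DivMod using (_%_)
open import Data.Integer as ℤ using (ℤ; +_; _-_; _*_; _+_; -_)
open import Data.Integer.Divisibility using (_∣_)
open import Data.Product using (Σ; ∃; _×_)
open import Relation.Binary.PropositionalEquality using (_≡_)
open import Relation.Nullary using (¬_)

Odd : ℕ → Set
Odd k = k % 2 ≡ 1

Even : ℕ → Set
Even k = k % 2 ≡ 0

infix 4 _≡_[mod_]
_≡_[mod_] : ℤ → ℤ → ℕ → Set
a ≡ b [mod m ] = (+ m) ∣ (a - b)

_^ℤ_ : ℤ → ℕ → ℤ
a ^ℤ ℕ.zero = + 1
a ^ℤ suc e = a * (a ^ℤ e)

-- The p-adic integers as the inverse limit  lim ℤ/p^m ℤ :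
-- a p-adic integer is a sequence (a m) of integers, a m representing a
-- residue class mod p^m, with a (m+1) ≡ a m (mod p^m).
record ℤ[_] (p : ℕ) : Set where
  constructor mkℤp
  field
    digits : ℕ → ℤ
    coherent : ∀ m → digits (suc m) ≡ digits m [mod p ^ m ]
open ℤ[_] public

-- p divides the p-adic integer a  iff  its residue mod p is zero
_∣ₚ_ : (p : ℕ) → ℤ[ p ] → Set
p ∣ₚ a = (+ p) ∣ digits a 1

-- equality x^2 + B y^2 = C z^n in ℤ_p: holds in every quotient ℤ/p^m
SatisfiesEq : (n : ℕ) (B C : ℤ) (p : ℕ) → ℤ[ p ] → ℤ[ p ] → ℤ[ p ] → Set
SatisfiesEq n B C p x y z =
  ∀ m → ((digits x m ^ℤ 2) + B * (digits y m ^ℤ 2))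
          ≡ C * (digits z m ^ℤ n) [mod p ^ m ]

-- primitive: no prime element of ℤ_p (i.e. no associate of p) divides all three
Primitive : (p : ℕ) → ℤ[ p ] → ℤ[ p ] → ℤ[ p ] → Set
Primitive p x y z = ¬ ((p ∣ₚ x) × (p ∣ₚ y) × (p ∣ₚ z))

YNonempty : (n : ℕ) (B C : ℤ) (p : ℕ) → Set
YNonempty n B C p =
  Σ ℤ[ p ] λ x → Σ ℤ[ p ] λ y → Σ ℤ[ p ] λ z →
    SatisfiesEq n B C p x y z × Primitive p x y z

LegendreMinusOne : ℤ → ℕ → Set
LegendreMinusOne a p = ¬ ((+ p) ∣ a) × ¬ (∃ λ t → (t ^ℤ 2) ≡ a [mod p ])

-- Write B = pᵏB′, C = pˡC′, n = 2h + 1 and Q(x, y) = x² + pᵏB′y². A primitive p-adic solution of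
-- Q(x, y) = pˡC′zⁿ yields either (p ∤ z) a value of Q of valuation exactly ℓ, or (p ∣ z) a zero of Q
-- modulo p^(ℓ+n) with x, y not both divisible by p. By descent on valuations, Q takes no odd
-- valuation below k, none at all if -B′ is a non-square mod p (for p = 2: if B′ ≡ 3 mod 8), and
-- modulo a high enough power of p its zeros are divisible by p; under each of (i)–(v) this excludes
-- both alternatives. In all other cases an explicit point is written down, with x equal to pʲ times
-- a p-adic square root obtained by Hensel lifting.

module Submission where

open import Defs

-- The development uses signed divisibility; the statement at the end uses the unsigned one.
module Solubility where

  open import Data.Nat as ℕ using (ℕ; zero; suc; _≤_; _<_; _∸_; z≤n; s≤s)
  open import Data.Nat.DivMod using (_%_; _/_; m≡m%n+[m/n]*n; [m+kn]%n≡m%n; m%n<n)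
  import Data.Nat.Properties as ℕ
  import Data.Nat.Divisibility as ℕ
  open import Data.Nat.Coprimality using (coprime-Bézout)
  open import Data.Nat.GCD using (module Bézout)
  open import Data.Nat.Primality
    using (Prime; prime[2]; ¬prime[0]; ¬prime[1]; euclidsLemma; prime⇒nonZero; prime⇒irreducible)
  open import Data.Integer as ℤ using (ℤ; +_; -[1+_]; _+_; _*_; _-_; -_)
  import Data.Integer.Properties as ℤ
  open import Data.Integer.DivMod using (_%ℕ_; _/ℕ_; a≡a%ℕn+[a/ℕn]*n; n%ℕd<d)
  open import Data.Integer.Divisibility using () renaming (_∣_ to _∣ᵤ_)
  open import Data.Integer.Divisibility.Signed
  open import Data.Integer.Tactic.RingSolver using (solve-∀)
  import Data.Nat.Tactic.RingSolver as ℕ-Solver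
  open import Data.Fin using (Fin; toℕ; fromℕ<)
  open import Data.Fin.Properties using (any?; toℕ-fromℕ<)
  open import Data.Product using (∃; _×_; _,_; proj₁; proj₂; map)
  open import Data.Sum using (_⊎_; inj₁; inj₂; [_,_]′; reduce)
  open import Data.Empty using (⊥-elim)
  open import Relation.Nullary using (¬_; yes; no)
  open import Relation.Nullary.Decidable using (False; toWitnessFalse)
  open import Relation.Binary.PropositionalEquality

  infixr 8 _↑_
  _↑_ : ℕ → ℕ → ℤ
  p ↑ m = + (p ℕ.^ m)

  ↑-+ : ∀ p a b → p ↑ (a ℕ.+ b) ≡ p ↑ a * p ↑ b
  ↑-+ p a b = trans (cong +_ (ℕ.^-distribˡ-+-* p a b)) (ℤ.pos-* (p ℕ.^ a) (p ℕ.^ b))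

  ↑-suc : ∀ p m → p ↑ suc m ≡ + p * p ↑ m
  ↑-suc p m = ℤ.pos-* p (p ℕ.^ m)

  ↑-1 : ∀ p → p ↑ 1 ≡ + p
  ↑-1 p = cong +_ (ℕ.*-identityʳ p)

  ↑-2 : ∀ p → p ↑ 2 ≡ + p * + p
  ↑-2 p = trans (↑-suc p 1) (cong (+ p *_) (↑-1 p))

  ↑-monoʳ-∣ : ∀ p {a b} → a ≤ b → p ↑ a ∣ p ↑ b
  ↑-monoʳ-∣ p {a} {b} a≤b = divides (p ↑ (b ∸ a)) (begin
    p ↑ b                 ≡⟨ cong (p ↑_) (ℕ.m+[n∸m]≡n a≤b) ⟨
    p ↑ (a ℕ.+ (b ∸ a))   ≡⟨ ↑-+ p a (b ∸ a) ⟩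
    p ↑ a * p ↑ (b ∸ a)   ≡⟨ ℤ.*-comm (p ↑ a) _ ⟩
    p ↑ (b ∸ a) * p ↑ a   ∎)
    where open ≡-Reasoning

  p∣↑ : ∀ p {e} → 1 ≤ e → + p ∣ p ↑ e
  p∣↑ p {e} le = subst (_∣ p ↑ e) (↑-1 p) (↑-monoʳ-∣ p le)

  ^ℤ-2 : ∀ x → x ^ℤ 2 ≡ x * x
  ^ℤ-2 x = cong (x *_) (ℤ.*-identityʳ x)

  ^ℤ-distribˡ-+-* : ∀ x a b → x ^ℤ (a ℕ.+ b) ≡ x ^ℤ a * x ^ℤ b
  ^ℤ-distribˡ-+-* x zero    b = sym (ℤ.*-identityˡ _)
  ^ℤ-distribˡ-+-* x (suc a) b =
    trans (cong (x *_) (^ℤ-distribˡ-+-* x a b)) (sym (ℤ.*-assoc x (x ^ℤ a) (x ^ℤ b)))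

  ^ℤ-distribʳ-* : ∀ x y n → (x * y) ^ℤ n ≡ x ^ℤ n * y ^ℤ n
  ^ℤ-distribʳ-* x y zero    = refl
  ^ℤ-distribʳ-* x y (suc n) =
    trans (cong (x * y *_) (^ℤ-distribʳ-* x y n)) (interchange x y (x ^ℤ n) (y ^ℤ n))
    where
    interchange : ∀ x y a b → x * y * (a * b) ≡ x * a * (y * b)
    interchange = solve-∀

  +^ℤ≡↑ : ∀ p m → (+ p) ^ℤ m ≡ p ↑ m
  +^ℤ≡↑ p zero    = refl
  +^ℤ≡↑ p (suc m) = trans (cong (+ p *_) (+^ℤ≡↑ p m)) (sym (↑-suc p m))

  ↑-^ℤ : ∀ p c m → (p ↑ c) ^ℤ m ≡ p ↑ (c ℕ.* m)
  ↑-^ℤ p c zero    = cong (p ↑_) (sym (ℕ.*-zeroʳ c))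
  ↑-^ℤ p c (suc m) = begin
    p ↑ c * (p ↑ c) ^ℤ m     ≡⟨ cong (p ↑ c *_) (↑-^ℤ p c m) ⟩
    p ↑ c * p ↑ (c ℕ.* m)    ≡⟨ ↑-+ p c (c ℕ.* m) ⟨
    p ↑ (c ℕ.+ c ℕ.* m)      ≡⟨ cong (p ↑_) (ℕ.*-suc c m) ⟨
    p ↑ (c ℕ.* suc m)        ∎
    where open ≡-Reasoning

  ^ℤ-square : ∀ c h → c ^ℤ suc h * c ^ℤ suc h ≡ c * c ^ℤ suc (h ℕ.+ h)
  ^ℤ-square c h = trans (sym (^ℤ-distribˡ-+-* c (suc h) (suc h))) (cong (c ^ℤ_) (ℕ.+-suc (suc h) h))

  ∣0 : ∀ d → d ∣ + 0
  ∣0 d = divides (+ 0) refl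

  ∣-≡ : ∀ {d a b} → a ≡ b → d ∣ a → d ∣ b
  ∣-≡ refl d∣a = d∣a

  ∣m-n∣n⇒∣m : ∀ {d m n} → d ∣ m - n → d ∣ n → d ∣ m
  ∣m-n∣n⇒∣m {d} {m} {n} h1 h2 = ∣-≡ (cancel m n) (∣m∣n⇒∣m+n h1 h2)
    where
    cancel : ∀ m n → m - n + n ≡ m
    cancel = solve-∀

  ∣-* : ∀ {a b c d} → a ∣ b → c ∣ d → a * c ∣ b * d
  ∣-* {a} {b} {c} {d} a∣b c∣d = ∣-trans (*-monoˡ-∣ c a∣b) (*-monoʳ-∣ b c∣d)

  ∣-^ℤ : ∀ {d} x y m → d ∣ x - y → d ∣ x ^ℤ m - y ^ℤ m
  ∣-^ℤ x y zero    _ = ∣-≡ (sym (ℤ.+-inverseʳ (+ 1))) (∣0 _)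
  ∣-^ℤ x y (suc m) h = ∣-≡ (telescope x y (x ^ℤ m) (y ^ℤ m))
    (∣m∣n⇒∣m+n (∣n⇒∣m*n x (∣-^ℤ x y m h)) (∣m⇒∣m*n (y ^ℤ m) h))
    where
    telescope : ∀ x y a b → x * (a - b) + (x - y) * b ≡ x * a - y * b
    telescope = solve-∀

  h+h≢1+j+j : ∀ h j → h ℕ.+ h ≢ suc (j ℕ.+ j)
  h+h≢1+j+j zero    j ()
  h+h≢1+j+j (suc h) zero e = ℕ.1+n≢0 (trans (sym (ℕ.+-suc h h)) (ℕ.suc-injective e))
  h+h≢1+j+j (suc h) (suc j) e = h+h≢1+j+j h j
    (ℕ.suc-injective (trans (sym (ℕ.+-suc h h)) (trans (ℕ.suc-injective e) (cong suc (ℕ.+-suc j j)))))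

  odd-1+j+j : ∀ j → Odd (suc (j ℕ.+ j))
  odd-1+j+j j = trans (cong (_% 2) (double j)) ([m+kn]%n≡m%n 1 j 2)
    where
    double : ∀ j → suc (j ℕ.+ j) ≡ 1 ℕ.+ j ℕ.* 2
    double = ℕ-Solver.solve-∀

  even-h+h : ∀ h → Even (h ℕ.+ h)
  even-h+h h = trans (cong (_% 2) (double h)) ([m+kn]%n≡m%n 0 h 2)
    where
    double : ∀ h → h ℕ.+ h ≡ 0 ℕ.+ h ℕ.* 2
    double = ℕ-Solver.solve-∀

  even⊎odd : ∀ m → (∃ λ h → m ≡ h ℕ.+ h) ⊎ (∃ λ j → m ≡ suc (j ℕ.+ j))
  even⊎odd m with m % 2 | m%n<n m 2 | m≡m%n+[m/n]*n m 2
  ... | 0 | _ | m≡ = inj₁ (m / 2 , trans m≡ (double (m / 2)))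
    where
    double : ∀ q → 0 ℕ.+ q ℕ.* 2 ≡ q ℕ.+ q
    double = ℕ-Solver.solve-∀
  ... | 1 | _ | m≡ = inj₂ (m / 2 , trans m≡ (double (m / 2)))
    where
    double : ∀ q → 1 ℕ.+ q ℕ.* 2 ≡ suc (q ℕ.+ q)
    double = ℕ-Solver.solve-∀
  ... | suc (suc _) | s≤s (s≤s ()) | _

  odd⇒≡1+j+j : ∀ m → Odd m → ∃ λ j → m ≡ suc (j ℕ.+ j)
  odd⇒≡1+j+j m odd-m with even⊎odd m
  ... | inj₂ m≡1+j+j = m≡1+j+j
  ... | inj₁ (h , refl) = ⊥-elim (ℕ.0≢1+n (trans (sym (even-h+h h)) odd-m))

  even⇒≡h+h : ∀ m → Even m → ∃ λ h → m ≡ h ℕ.+ h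
  even⇒≡h+h m even-m with even⊎odd m
  ... | inj₁ m≡h+h = m≡h+h
  ... | inj₂ (j , refl) = ⊥-elim (ℕ.0≢1+n (trans (sym even-m) (odd-1+j+j j)))

  h+h<1+j+j⇒h≤j : ∀ h j → h ℕ.+ h < suc (j ℕ.+ j) → h ≤ j
  h+h<1+j+j⇒h≤j h j h+h<1+j+j with ℕ.≤-<-connex h j
  ... | inj₁ h≤j = h≤j
  ... | inj₂ j<h = ⊥-elim (ℕ.<-irrefl refl (ℕ.<-≤-trans h+h<1+j+j
          (ℕ.≤-trans (s≤s (ℕ.+-monoʳ-≤ j (ℕ.n≤1+n j))) (ℕ.+-mono-≤ j<h j<h))))

  m+m≤h+h≤1+m+m⇒h+h≡m+m : ∀ h m → m ℕ.+ m ≤ h ℕ.+ h → h ℕ.+ h ≤ suc (m ℕ.+ m) → h ℕ.+ h ≡ m ℕ.+ m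
  m+m≤h+h≤1+m+m⇒h+h≡m+m h m m+m≤h+h h+h≤1+m+m with ℕ.m≤n⇒m<n∨m≡n h+h≤1+m+m
  ... | inj₁ h+h<1+m+m = ℕ.≤-antisym (ℕ.≤-pred h+h<1+m+m) m+m≤h+h
  ... | inj₂ h+h≡1+m+m = ⊥-elim (h+h≢1+j+j h m h+h≡1+m+m)

  ¬∣ : ∀ m n {m∤n : False (m ℕ.∣? n)} → ¬ (+ m ∣ + n)
  ¬∣ m n {m∤n} m∣n = toWitnessFalse m∤n (∣⇒∣ᵤ m∣n)

  divMod : ∀ X d .{{_ : ℕ.NonZero d}} → ∃ λ r → r < d × ∃ λ q → X ≡ + r + q * + d
  divMod X d = X %ℕ d , n%ℕd<d X d , X /ℕ d , a≡a%ℕn+[a/ℕn]*n X d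

  data Parity (X : ℤ) : Set where
    even : ∀ q → X ≡ q * + 2 → Parity X
    odd  : ∀ q → X ≡ q * + 2 + + 1 → Parity X

  parity : ∀ X → Parity X
  parity X with divMod X 2
  ... | 0 , _ , q , X≡ = even q (trans X≡ (ℤ.+-identityˡ _))
  ... | 1 , _ , q , X≡ = odd q (trans X≡ (ℤ.+-comm (+ 1) (q * + 2)))
  ... | suc (suc _) , s≤s (s≤s ()) , _

  odd⇒8∣x²-1 : ∀ X → ¬ (+ 2 ∣ X) → + 8 ∣ X * X - + 1
  odd⇒8∣x²-1 X 2∤X with parity X
  ... | even q refl = ⊥-elim (2∤X (divides q refl))
  ... | odd q refl with parity q
  ...   | even r refl = divides (r * r * + 2 + r) (expand r)
    where
    expand : ∀ r → (r * + 2 * + 2 + + 1) * (r * + 2 * + 2 + + 1) - + 1 ≡ (r * r * + 2 + r) * + 8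
    expand = solve-∀
  ...   | odd r refl = divides (r * r * + 2 + r * + 3 + + 1) (expand r)
    where
    expand : ∀ r → ((r * + 2 + + 1) * + 2 + + 1) * ((r * + 2 + + 1) * + 2 + + 1) - + 1
                   ≡ (r * r * + 2 + r * + 3 + + 1) * + 8
    expand = solve-∀

  odd⇒8∣x^odd-x : ∀ X → ¬ (+ 2 ∣ X) → ∀ h → + 8 ∣ X ^ℤ suc (h ℕ.+ h) - X
  odd⇒8∣x^odd-x X 2∤X zero = ∣-≡ (sym (trans (cong (_- X) (ℤ.*-identityʳ X)) (ℤ.+-inverseʳ X))) (∣0 _)
  odd⇒8∣x^odd-x X 2∤X (suc h) = ∣-≡ (sym split)
    (∣m∣n⇒∣m+n (∣m⇒∣m*n (X ^ℤ suc (h ℕ.+ h)) (odd⇒8∣x²-1 X 2∤X)) (odd⇒8∣x^odd-x X 2∤X h))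
    where
    regroup : ∀ X V → X * (X * V) - X ≡ (X * X - + 1) * V + (V - X)
    regroup = solve-∀
    split : X ^ℤ suc (suc h ℕ.+ suc h) - X ≡ (X * X - + 1) * X ^ℤ suc (h ℕ.+ h) + (X ^ℤ suc (h ℕ.+ h) - X)
    split = trans (cong (λ m → X ^ℤ suc m - X) (ℕ.+-suc (suc h) h)) (regroup X (X ^ℤ suc (h ℕ.+ h)))

  2∣x-1⇒2∤x : ∀ X → + 2 ∣ X - + 1 → ¬ (+ 2 ∣ X)
  2∣x-1⇒2∤x X 2∣X-1 2∣X = ¬∣ 2 1 (∣-≡ (cancel X) (∣m∣n⇒∣m-n 2∣X 2∣X-1))
    where
    cancel : ∀ X → X - (X - + 1) ≡ + 1
    cancel = solve-∀

  private
    8∣⇒2∣ : ∀ {a} → + 8 ∣ a → + 2 ∣ a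
    8∣⇒2∣ = ∣-trans (divides (+ 4) refl)

    8∣⇒4∣ : ∀ {a} → + 8 ∣ a → + 4 ∣ a
    8∣⇒4∣ = ∣-trans (divides (+ 2) refl)

    4∣⇒2∣ : ∀ {a} → + 4 ∣ a → + 2 ∣ a
    4∣⇒2∣ = ∣-trans (divides (+ 2) refl)

    even⇒4∣x² : ∀ q → + 4 ∣ q * + 2 * (q * + 2)
    even⇒4∣x² q = divides (q * q) (regroup q)
      where
      regroup : ∀ q → q * + 2 * (q * + 2) ≡ q * q * + 4
      regroup = solve-∀

    2∤2q+1 : ∀ q → ¬ (+ 2 ∣ q * + 2 + + 1)
    2∤2q+1 q = 2∣x-1⇒2∤x _ (divides q (cancel q))
      where
      cancel : ∀ q → q * + 2 + + 1 - + 1 ≡ q * + 2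
      cancel = solve-∀

    2∣8q : ∀ q → + 2 ∣ q * + 8
    2∣8q q = ∣n⇒∣m*n q (divides (+ 4) refl)

    shift8 : ∀ r q → r + q * + 8 - r ≡ q * + 8
    shift8 = solve-∀

  odd-mod8 : ∀ B → ¬ (+ 2 ∣ B) → + 8 ∣ B - + 1 ⊎ + 8 ∣ B - + 3 ⊎ + 8 ∣ B - + 5 ⊎ + 8 ∣ B - + 7
  odd-mod8 B 2∤B with divMod B 8
  ... | 0 , _ , q , refl = ⊥-elim (2∤B (∣m∣n⇒∣m+n (∣0 _) (2∣8q q)))
  ... | 1 , _ , q , refl = inj₁ (divides q (shift8 (+ 1) q))
  ... | 2 , _ , q , refl = ⊥-elim (2∤B (∣m∣n⇒∣m+n ∣-refl (2∣8q q)))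
  ... | 3 , _ , q , refl = inj₂ (inj₁ (divides q (shift8 (+ 3) q)))
  ... | 4 , _ , q , refl = ⊥-elim (2∤B (∣m∣n⇒∣m+n (divides (+ 2) refl) (2∣8q q)))
  ... | 5 , _ , q , refl = inj₂ (inj₂ (inj₁ (divides q (shift8 (+ 5) q))))
  ... | 6 , _ , q , refl = ⊥-elim (2∤B (∣m∣n⇒∣m+n (divides (+ 3) refl) (2∣8q q)))
  ... | 7 , _ , q , refl = inj₂ (inj₂ (inj₂ (divides q (shift8 (+ 7) q))))
  ... | suc (suc (suc (suc (suc (suc (suc (suc _))))))) , s≤s (s≤s (s≤s (s≤s (s≤s (s≤s (s≤s (s≤s ()))))))) , _

  4∣B-1⇒B≡2b-1 : ∀ B → + 4 ∣ B - + 1 → ∃ λ b → B ≡ b + b - + 1 × ¬ (+ 2 ∣ b)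
  4∣B-1⇒B≡2b-1 B (divides q B-1≡) = q * + 2 + + 1 , solve-for-B B q B-1≡ , 2∤2q+1 q
    where
    solve-for-B : ∀ B q → B - + 1 ≡ q * + 4 → B ≡ q * + 2 + + 1 + (q * + 2 + + 1) - + 1
    solve-for-B B q e = trans (shift B) (trans (cong (_+ + 1) e) (regroup q))
      where
      shift : ∀ B → B ≡ B - + 1 + + 1
      shift = solve-∀
      regroup : ∀ q → q * + 4 + + 1 ≡ q * + 2 + + 1 + (q * + 2 + + 1) - + 1
      regroup = solve-∀

  module _ {p : ℕ} (pr : Prime p) where

    private
      instance
        p≢0 : ℕ.NonZero p
        p≢0 = prime⇒nonZero pr

    p∤1 : ¬ (+ p ∣ + 1)
    p∤1 p∣1 = ¬prime[1] (subst Prime (ℕ.∣1⇒≡1 (∣⇒∣ᵤ p∣1)) pr)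

    p∣xy⇒p∣x⊎p∣y : ∀ x y → + p ∣ x * y → + p ∣ x ⊎ + p ∣ y
    p∣xy⇒p∣x⊎p∣y x y p∣xy
      with euclidsLemma (ℤ.∣ x ∣) (ℤ.∣ y ∣) pr (subst (p ℕ.∣_) (ℤ.abs-* x y) (∣⇒∣ᵤ p∣xy))
    ... | inj₁ p∣x = inj₁ (∣ᵤ⇒∣ p∣x)
    ... | inj₂ p∣y = inj₂ (∣ᵤ⇒∣ p∣y)

    p∤x⇒p∤y⇒p∤xy : ∀ {x y} → ¬ (+ p ∣ x) → ¬ (+ p ∣ y) → ¬ (+ p ∣ x * y)
    p∤x⇒p∤y⇒p∤xy {x} {y} p∤x p∤y p∣xy = [ p∤x , p∤y ]′ (p∣xy⇒p∣x⊎p∣y x y p∣xy)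

    p∣x²⇒p∣x : ∀ x → + p ∣ x * x → + p ∣ x
    p∣x²⇒p∣x x p∣x² = reduce (p∣xy⇒p∣x⊎p∣y x x p∣x²)

    p∤x⇒p∤x^n : ∀ {x} → ¬ (+ p ∣ x) → ∀ n → ¬ (+ p ∣ x ^ℤ n)
    p∤x⇒p∤x^n p∤x zero    = p∤1
    p∤x⇒p∤x^n p∤x (suc n) = p∤x⇒p∤y⇒p∤xy p∤x (p∤x⇒p∤x^n p∤x n)

    p∤xy⇒p∤x×p∤y : ∀ x y → ¬ (+ p ∣ᵤ x * y) → ¬ (+ p ∣ x) × ¬ (+ p ∣ y)
    p∤xy⇒p∤x×p∤y x y p∤xy =
      (λ p∣x → p∤xy (∣⇒∣ᵤ (∣m⇒∣m*n y p∣x))) , (λ p∣y → p∤xy (∣⇒∣ᵤ (∣n⇒∣m*n x p∣y)))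

    ↑-cancelˡ-∣ : ∀ j {a b} → p ↑ j * a ∣ p ↑ j * b → a ∣ b
    ↑-cancelˡ-∣ j = *-cancelˡ-∣ (p ↑ j) {{ℕ.m^n≢0 p j}}

    ↑suc∣↑*x⇒p∣x : ∀ j {x} → p ↑ suc j ∣ p ↑ j * x → + p ∣ x
    ↑suc∣↑*x⇒p∣x j {x} h =
      ↑-cancelˡ-∣ j (subst (_∣ p ↑ j * x) (trans (↑-suc p j) (ℤ.*-comm (+ p) (p ↑ j))) h)

    ∃-inverse : ∀ a → ¬ (+ p ∣ a) → ∃ λ u → + p ∣ u * a - + 1
    ∃-inverse a p∤a = ofAbs a (fromBézout (coprime-Bézout coprime))
      where
      coprime : ∀ {d} → d ℕ.∣ p × d ℕ.∣ ℤ.∣ a ∣ → d ≡ 1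
      coprime (d∣p , d∣a) with prime⇒irreducible pr d∣p
      ... | inj₁ d≡1 = d≡1
      ... | inj₂ refl = ⊥-elim (p∤a (∣ᵤ⇒∣ d∣a))
      fromBézout : Bézout.Identity 1 p ℤ.∣ a ∣ → ∃ λ u → + p ∣ u * + ℤ.∣ a ∣ - + 1
      fromBézout (Bézout.+- x y eq) = - + y , divides (- + x) (shift (+ x) (+ y) (+ ℤ.∣ a ∣) (+ p) (begin
          + 1 + + y * + ℤ.∣ a ∣      ≡⟨ cong (λ t → + 1 + t) (ℤ.pos-* y ℤ.∣ a ∣) ⟨
          + (1 ℕ.+ y ℕ.* ℤ.∣ a ∣)    ≡⟨ cong +_ eq ⟩
          + (x ℕ.* p)                ≡⟨ ℤ.pos-* x p ⟩
          + x * + p                  ∎))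
        where
        open ≡-Reasoning
        shift : ∀ x y m p → + 1 + y * m ≡ x * p → - y * m - + 1 ≡ - x * p
        shift x y m p e = trans (reassoc y m) (trans (cong -_ e) (ℤ.neg-distribˡ-* x p))
          where
          reassoc : ∀ y m → - y * m - + 1 ≡ - (+ 1 + y * m)
          reassoc = solve-∀
      fromBézout (Bézout.-+ x y eq) = + y , divides (+ x) (shift (+ x) (+ y) (+ ℤ.∣ a ∣) (+ p) (begin
          + 1 + + x * + p            ≡⟨ cong (λ t → + 1 + t) (ℤ.pos-* x p) ⟨
          + (1 ℕ.+ x ℕ.* p)          ≡⟨ cong +_ eq ⟩
          + (y ℕ.* ℤ.∣ a ∣)          ≡⟨ ℤ.pos-* y ℤ.∣ a ∣ ⟩
          + y * + ℤ.∣ a ∣            ∎))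
        where
        open ≡-Reasoning
        shift : ∀ x y m p → + 1 + x * p ≡ y * m → y * m - + 1 ≡ x * p
        shift x y m p e = trans (cong (_- + 1) (sym e)) (cancel x p)
          where
          cancel : ∀ x p → + 1 + x * p - + 1 ≡ x * p
          cancel = solve-∀
      ofAbs : ∀ a → (∃ λ u → + p ∣ u * + ℤ.∣ a ∣ - + 1) → ∃ λ u → + p ∣ u * a - + 1
      ofAbs (+ m)    h       = h
      ofAbs -[1+ m ] (u , d) = - u , ∣-≡ (negate u (+ suc m)) d
        where
        negate : ∀ u m → u * m - + 1 ≡ - u * - m - + 1
        negate = solve-∀

    sqrt-mod? : ∀ a → (∃ λ t → + p ∣ t * t - a) ⊎ ¬ (∃ λ t → t ^ℤ 2 ≡ a [mod p ])
    sqrt-mod? a with any? {n = p} (λ r → + p ∣? + toℕ r * + toℕ r - a)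
    ... | yes (r , p∣r²-a) = inj₁ (+ toℕ r , p∣r²-a)
    ... | no  ¬residue     = inj₂ λ (t , t²≡a) → ¬residue (toResidue t (∣ᵤ⇒∣ t²≡a))
      where
      toResidue : ∀ t → + p ∣ t ^ℤ 2 - a → ∃ λ (r : Fin p) → + p ∣ + toℕ r * + toℕ r - a
      toResidue t p∣t²-a with divMod t p
      ... | r , r<p , q , refl = fromℕ< r<p , subst (λ z → + p ∣ + z * + z - a) (sym (toℕ-fromℕ< r<p))
              (∣-≡ (sym (shift (+ r) q (+ p) a))
                   (∣m∣n⇒∣m-n (∣-≡ (cong (_- a) (^ℤ-2 (+ r + q * + p))) p∣t²-a) (∣m⇒∣m*n _ ∣-refl)))
        where
        shift : ∀ r q p a → r * r - a ≡ (r + q * p) * (r + q * p) - a - p * (+ 2 * r * q + q * q * p)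
        shift = solve-∀

  -- Valuations of the binary form X² + B W²

  Q : ℤ → ℤ → ℤ → ℤ
  Q B X W = X * X + B * (W * W)

  Anisotropic : ℕ → ℕ → (ℤ → ℤ → ℤ) → Set
  Anisotropic p e f = ∀ X Y → p ↑ e ∣ f X Y → + p ∣ X × + p ∣ Y

  Skips : ℕ → ℕ → (ℤ → ℤ → ℤ) → Set
  Skips p ℓ f = ∀ X Y → p ↑ ℓ ∣ f X Y → p ↑ suc ℓ ∣ f X Y

  anisotropic-mono : ∀ {p e e′ f} → e ≤ e′ → Anisotropic p e f → Anisotropic p e′ f
  anisotropic-mono {p} e≤e′ aniso X Y h = aniso X Y (∣-trans (↑-monoʳ-∣ p e≤e′) h)

  Q-scale : ∀ B x w c → Q B (x * c) (w * c) ≡ c * c * Q B x w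
  Q-scale B x w c = expanded B x w c
    where
    expanded : ∀ B x w c → x * c * (x * c) + B * (w * c * (w * c)) ≡ c * c * (x * x + B * (w * w))
    expanded = solve-∀

  Q-twist : ∀ p h B X Y → Q (p ↑ (h ℕ.+ h) * B) X Y ≡ Q B X (p ↑ h * Y)
  Q-twist p h B X Y = trans (cong (λ t → X * X + t * B * (Y * Y)) (↑-+ p h h)) (regroup X (p ↑ h) B Y)
    where
    regroup : ∀ X a B Y → X * X + a * a * B * (Y * Y) ≡ X * X + B * (a * Y * (a * Y))
    regroup = solve-∀

  ↑-*-∣ : ∀ p a b {x y} → p ↑ a ∣ x → p ↑ b ∣ y → p ↑ (a ℕ.+ b) ∣ x * y
  ↑-*-∣ p a b {x} {y} h1 h2 = subst (_∣ x * y) (sym (↑-+ p a b)) (∣-* h1 h2)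

  ↑-∣-Q : ∀ p a B {X W} → p ↑ a ∣ X → p ↑ a ∣ W → p ↑ (a ℕ.+ a) ∣ Q B X W
  ↑-∣-Q p a B h1 h2 = ∣m∣n⇒∣m+n (↑-*-∣ p a a h1 h1) (∣n⇒∣m*n B (↑-*-∣ p a a h2 h2))

  ↑∣x⇒↑suc∣x*p : ∀ p j {x} → p ↑ j ∣ x → p ↑ suc j ∣ x * + p
  ↑∣x⇒↑suc∣x*p p j {x} h =
    subst (_∣ x * + p) (trans (ℤ.*-comm (p ↑ j) (+ p)) (sym (↑-suc p j))) (∣-* h (∣-refl {+ p}))

  Q-twist-skips : ∀ p ℓ B h → Skips p ℓ (Q B) → Skips p ℓ (Q (p ↑ (h ℕ.+ h) * B))
  Q-twist-skips p ℓ B h skips X Y h∣ =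
    subst (_ ∣_) (sym (Q-twist p h B X Y)) (skips X (p ↑ h * Y) (subst (_ ∣_) (Q-twist p h B X Y) h∣))

  module _ {p : ℕ} (pr : Prime p) where

    private
      ↑suc∣x⇒p∣x : ∀ j {x} → p ↑ suc j ∣ x → + p ∣ x
      ↑suc∣x⇒p∣x j h = ∣-trans (p∣↑ p {suc j} (s≤s z≤n)) h

      two-more : ∀ e j → e ℕ.+ (suc j ℕ.+ suc j) ≡ 2 ℕ.+ (e ℕ.+ (j ℕ.+ j))
      two-more = ℕ-Solver.solve-∀

    anisotropic-descent : ∀ B e → Anisotropic p e (Q B) →
      ∀ j X W → p ↑ (e ℕ.+ (j ℕ.+ j)) ∣ Q B X W → p ↑ suc j ∣ X × p ↑ suc j ∣ W
    anisotropic-descent B e aniso zero X W h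
      with aniso X W (subst (λ m → p ↑ m ∣ Q B X W) (ℕ.+-identityʳ e) h)
    ... | p∣X , p∣W = subst (_∣ X) (sym (↑-1 p)) p∣X , subst (_∣ W) (sym (↑-1 p)) p∣W
    anisotropic-descent B e aniso (suc j) X W h
      with aniso X W (∣-trans (↑-monoʳ-∣ p (ℕ.m≤m+n e (suc j ℕ.+ suc j))) h)
    ... | divides x refl , divides w refl =
      ↑∣x⇒↑suc∣x*p p (suc j) (proj₁ ih) , ↑∣x⇒↑suc∣x*p p (suc j) (proj₂ ih)
      where
      scaled : p ↑ 2 * p ↑ (e ℕ.+ (j ℕ.+ j)) ∣ p ↑ 2 * Q B x w
      scaled = subst₂ _∣_
        (trans (cong (p ↑_) (two-more e j)) (↑-+ p 2 (e ℕ.+ (j ℕ.+ j))))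
        (trans (Q-scale B x w (+ p)) (cong (_* Q B x w) (sym (↑-2 p)))) h
      ih : p ↑ suc j ∣ x × p ↑ suc j ∣ w
      ih = anisotropic-descent B e aniso j x w (↑-cancelˡ-∣ pr 2 scaled)

    ↑odd∣x²⇒↑∣x : ∀ j x → p ↑ suc (j ℕ.+ j) ∣ x * x → p ↑ suc j ∣ x
    ↑odd∣x²⇒↑∣x zero x h = subst (_∣ x) (sym (↑-1 p)) (p∣x²⇒p∣x pr x (↑suc∣x⇒p∣x 0 h))
    ↑odd∣x²⇒↑∣x (suc j) x h with p∣x²⇒p∣x pr x (↑suc∣x⇒p∣x (suc (j ℕ.+ suc j)) h)
    ... | divides y refl = ↑∣x⇒↑suc∣x*p p (suc j) (↑odd∣x²⇒↑∣x j y (↑-cancelˡ-∣ pr 2 scaled))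
      where
      scaled : p ↑ 2 * p ↑ suc (j ℕ.+ j) ∣ p ↑ 2 * (y * y)
      scaled = subst₂ _∣_
        (trans (cong (p ↑_) (two-more 1 j)) (↑-+ p 2 (suc (j ℕ.+ j))))
        (trans (rearrange y (+ p)) (cong (_* (y * y)) (sym (↑-2 p)))) h
        where
        rearrange : ∀ y c → y * c * (y * c) ≡ c * c * (y * y)
        rearrange = solve-∀

    Q-twist-anisotropic : ∀ B e → Anisotropic p e (Q B) →
      ∀ h → Anisotropic p (e ℕ.+ (h ℕ.+ h)) (Q (p ↑ (h ℕ.+ h) * B))
    Q-twist-anisotropic B e aniso h X Y p↑∣Q
      with anisotropic-descent B e aniso h X (p ↑ h * Y) (subst (_ ∣_) (Q-twist p h B X Y) p↑∣Q)
    ... | ↑∣X , ↑∣p↑Y = ↑suc∣x⇒p∣x h ↑∣X , ↑suc∣↑*x⇒p∣x pr h ↑∣p↑Y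

    Q-oddTwist-anisotropic : ∀ B → ¬ (+ p ∣ B) →
      ∀ j → Anisotropic p (suc (suc (j ℕ.+ j))) (Q (p ↑ suc (j ℕ.+ j) * B))
    Q-oddTwist-anisotropic B p∤B j X Y h = ↑suc∣x⇒p∣x j ↑∣X , p∣Y
      where
      k = suc (j ℕ.+ j)
      ↑∣T : p ↑ k ∣ p ↑ k * B * (Y * Y)
      ↑∣T = ∣m⇒∣m*n (Y * Y) (∣m⇒∣m*n B ∣-refl)
      ↑∣X : p ↑ suc j ∣ X
      ↑∣X = ↑odd∣x²⇒↑∣x j X (∣m+n∣n⇒∣m (∣-trans (↑-monoʳ-∣ p (ℕ.n≤1+n k)) h) ↑∣T)
      ↑∣X² : p ↑ suc k ∣ X * X
      ↑∣X² = subst (λ m → p ↑ m ∣ X * X) (ℕ.+-suc (suc j) j) (↑-*-∣ p (suc j) (suc j) ↑∣X ↑∣X)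
      p∣BY² : + p ∣ B * (Y * Y)
      p∣BY² = ↑suc∣↑*x⇒p∣x pr k
        (subst (p ↑ suc k ∣_) (ℤ.*-assoc (p ↑ k) B (Y * Y)) (∣m+n∣m⇒∣n h ↑∣X²))
      p∣Y : + p ∣ Y
      p∣Y = [ (λ p∣B → ⊥-elim (p∤B p∣B)) , p∣x²⇒p∣x pr Y ]′ (p∣xy⇒p∣x⊎p∣y pr B (Y * Y) p∣BY²)

    Q-skips-below : ∀ j k B → suc (j ℕ.+ j) < k → Skips p (suc (j ℕ.+ j)) (Q (p ↑ k * B))
    Q-skips-below j k B lt X Y h = ∣m∣n⇒∣m+n ↑∣X² (↑∣T lt)
      where
      ↑∣T : ∀ {a} → a ≤ k → p ↑ a ∣ p ↑ k * B * (Y * Y)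
      ↑∣T le = ∣m⇒∣m*n (Y * Y) (∣m⇒∣m*n B (↑-monoʳ-∣ p le))
      ↑∣X : p ↑ suc j ∣ X
      ↑∣X = ↑odd∣x²⇒↑∣x j X (∣m+n∣n⇒∣m h (↑∣T (ℕ.<⇒≤ lt)))
      ↑∣X² : p ↑ suc (suc (j ℕ.+ j)) ∣ X * X
      ↑∣X² = subst (λ m → p ↑ m ∣ X * X) (ℕ.+-suc (suc j) j) (↑-*-∣ p (suc j) (suc j) ↑∣X ↑∣X)

    nonResidue⇒anisotropic : ∀ B → ¬ (∃ λ t → t ^ℤ 2 ≡ - B [mod p ]) → Anisotropic p 1 (Q B)
    nonResidue⇒anisotropic B nonRes X W p↑1∣Q with + p ∣? W
    ... | yes p∣W = p∣x²⇒p∣x pr X (∣m+n∣n⇒∣m p∣Q (∣n⇒∣m*n B (∣m⇒∣m*n W p∣W))) , p∣W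
      where
      p∣Q : + p ∣ Q B X W
      p∣Q = subst (_∣ Q B X W) (↑-1 p) p↑1∣Q
    -- X/W is a square root of -B modulo p.
    ... | no p∤W = ⊥-elim (nonRes (X * u , ∣⇒∣ᵤ (∣-≡ (sym identity)
          (∣m∣n⇒∣m-n (∣n⇒∣m*n (u * u) p∣Q) (∣n⇒∣m*n B (∣m⇒∣m*n (u * W + + 1) p∣uW-1))))))
      where
      p∣Q : + p ∣ Q B X W
      p∣Q = subst (_∣ Q B X W) (↑-1 p) p↑1∣Q
      u : ℤ
      u = proj₁ (∃-inverse pr W p∤W)
      p∣uW-1 : + p ∣ u * W - + 1
      p∣uW-1 = proj₂ (∃-inverse pr W p∤W)
      expand : ∀ X u B W → X * u * (X * u) - - B ≡ u * u * (X * X + B * (W * W)) - B * ((u * W - + 1) * (u * W + + 1))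
      expand = solve-∀
      identity : (X * u) ^ℤ 2 - - B ≡ u * u * Q B X W - B * ((u * W - + 1) * (u * W + + 1))
      identity = trans (cong (_- - B) (^ℤ-2 (X * u))) (expand X u B W)

    anisotropic⇒skips-odd : ∀ B → Anisotropic p 1 (Q B) → ∀ j → Skips p (suc (j ℕ.+ j)) (Q B)
    anisotropic⇒skips-odd B aniso j X W h with anisotropic-descent B 1 aniso j X W h
    ... | ↑∣X , ↑∣W = subst (λ m → p ↑ m ∣ Q B X W) (ℕ.+-suc (suc j) j) (↑-∣-Q p (suc j) B ↑∣X ↑∣W)

  Q-mod8 : ∀ B r X W → + 8 ∣ B - r → ¬ (+ 2 ∣ r) → + 2 ∣ Q B X W →
           (+ 2 ∣ X × + 2 ∣ W) ⊎ (+ 8 ∣ Q B X W - (+ 1 + r))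
  Q-mod8 B r X W B≡r 2∤r 2∣Q with parity X | parity W
  ... | even q refl | even s refl = inj₁ (divides q refl , divides s refl)
  ... | odd q refl  | odd s refl  = inj₂ (∣-≡ (regroup (q * + 2 + + 1) (s * + 2 + + 1) B r)
    (∣m∣n⇒∣m+n (∣m∣n⇒∣m+n (odd⇒8∣x²-1 _ (2∤2q+1 q)) (∣n⇒∣m*n B (odd⇒8∣x²-1 _ (2∤2q+1 s)))) B≡r))
    where
    regroup : ∀ X W B r → X * X - + 1 + B * (W * W - + 1) + (B - r) ≡ X * X + B * (W * W) - (+ 1 + r)
    regroup = solve-∀
  ... | even q refl | odd s refl = ⊥-elim (2∤r (∣-≡ (cancel (q * + 2) (s * + 2 + + 1) B r)
    (∣m∣n⇒∣m-n (∣m∣n⇒∣m-n 2∣Q (∣m∣n⇒∣m+n (4∣⇒2∣ (even⇒4∣x² q))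
      (∣n⇒∣m*n B (8∣⇒2∣ (odd⇒8∣x²-1 _ (2∤2q+1 s)))))) (8∣⇒2∣ B≡r))))
    where
    cancel : ∀ X W B r → X * X + B * (W * W) - (X * X + B * (W * W - + 1)) - (B - r) ≡ r
    cancel = solve-∀
  ... | odd q refl | even s refl = ⊥-elim (¬∣ 2 1 (∣-≡ (cancel (q * + 2 + + 1) (s * + 2) B)
    (∣m∣n⇒∣m-n 2∣Q (∣m∣n⇒∣m+n (8∣⇒2∣ (odd⇒8∣x²-1 _ (2∤2q+1 q))) (∣n⇒∣m*n B (4∣⇒2∣ (even⇒4∣x² s)))))))
    where
    cancel : ∀ X W B → X * X + B * (W * W) - (X * X - + 1 + B * (W * W)) ≡ + 1
    cancel = solve-∀

  mod8-anisotropic : ∀ B r e → 1 ≤ e → e ≤ 3 → + 8 ∣ B - r → ¬ (+ 2 ∣ r) → ¬ (2 ↑ e ∣ + 1 + r) →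
                     Anisotropic 2 e (Q B)
  mod8-anisotropic B r e 1≤e e≤3 B≡r 2∤r 2↑e∤1+r X W 2↑e∣Q
    with Q-mod8 B r X W B≡r 2∤r (∣-trans (↑-monoʳ-∣ 2 1≤e) 2↑e∣Q)
  ... | inj₁ 2∣X×2∣W = 2∣X×2∣W
  ... | inj₂ 8∣Q-1-r = ⊥-elim (2↑e∤1+r (∣-≡ (cancel (Q B X W) r)
          (∣m∣n⇒∣m-n 2↑e∣Q (∣-trans (↑-monoʳ-∣ 2 e≤3) 8∣Q-1-r))))
    where
    cancel : ∀ s r → s - (s - (+ 1 + r)) ≡ + 1 + r
    cancel = solve-∀

  private
    ≡3[8]⇒2∣Q⇒4∣Q : ∀ B X W → + 8 ∣ B - + 3 → + 2 ∣ Q B X W → + 4 ∣ Q B X W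
    ≡3[8]⇒2∣Q⇒4∣Q B X W B≡3 2∣Q with Q-mod8 B (+ 3) X W B≡3 (¬∣ 2 3) 2∣Q
    ... | inj₁ (2∣X , 2∣W) = ↑-∣-Q 2 1 B 2∣X 2∣W
    ... | inj₂ 8∣Q-4       = ∣m-n∣n⇒∣m (8∣⇒4∣ 8∣Q-4) (∣-refl {+ 4})

  ≡3[8]⇒skips-odd : ∀ B → + 8 ∣ B - + 3 → ∀ j → Skips 2 (suc (j ℕ.+ j)) (Q B)
  ≡3[8]⇒skips-odd B B≡3 zero X W h = ≡3[8]⇒2∣Q⇒4∣Q B X W B≡3 h
  ≡3[8]⇒skips-odd B B≡3 (suc j) X W h
    with anisotropic-descent prime[2] B 3
           (mod8-anisotropic B (+ 3) 3 (s≤s z≤n) ℕ.≤-refl B≡3 (¬∣ 2 3) (¬∣ 8 4)) j X W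
           (subst (λ m → 2 ↑ suc (suc m) ∣ Q B X W) (ℕ.+-suc j j) h)
  ... | divides x refl , divides w refl =
    subst₂ _∣_ (cong (2 ↑_) (ℕ.+-comm (j′ ℕ.+ j′) 2)) (sym scale)
      (↑-*-∣ 2 (j′ ℕ.+ j′) 2 ∣-refl (≡3[8]⇒2∣Q⇒4∣Q B x w B≡3 2∣Q))
    where
    j′ = suc j
    scale : Q B (x * 2 ↑ j′) (w * 2 ↑ j′) ≡ 2 ↑ (j′ ℕ.+ j′) * Q B x w
    scale = trans (Q-scale B x w (2 ↑ j′)) (cong (_* Q B x w) (sym (↑-+ 2 j′ j′)))
    2∣Q : + 2 ∣ Q B x w
    2∣Q = ↑suc∣↑*x⇒p∣x prime[2] (j′ ℕ.+ j′) (subst (_ ∣_) scale h)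

  -- Nonexistence of points

  module _ {p : ℕ} (pr : Prime p) where

    p∣digit⇒p∣ₚ : (x : ℤ[ p ]) → ∀ {m} → 1 ≤ m → + p ∣ digits x m → p ∣ₚ x
    p∣digit⇒p∣ₚ x {suc m} _ h =
      ∣⇒∣ᵤ (∣-≡ (cancel (digits x (suc m)) (digits x 1)) (∣m∣n⇒∣m-n h (digit≡digit₁ m)))
      where
      cancel : ∀ a c → a - (a - c) ≡ c
      cancel = solve-∀
      telescope : ∀ a b c → a - b + (b - c) ≡ a - c
      telescope = solve-∀
      digit≡digit₁ : ∀ m → + p ∣ digits x (suc m) - digits x 1
      digit≡digit₁ zero    = ∣-≡ (sym (ℤ.+-inverseʳ (digits x 1))) (∣0 _)
      digit≡digit₁ (suc m) = ∣-≡ (telescope (digits x (suc (suc m))) (digits x (suc m)) (digits x 1))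
        (∣m∣n⇒∣m+n (∣-trans (p∣↑ p {suc m} (s≤s z≤n)) step) (digit≡digit₁ m))
        where
        step : p ↑ suc m ∣ digits x (suc (suc m)) - digits x (suc m)
        step = ∣ᵤ⇒∣ (coherent x (suc m))

    solution-mod-↑⇒p∣all : ∀ n k ℓ B C → ¬ (+ p ∣ C) →
      Skips p ℓ (Q (p ↑ k * B)) → Anisotropic p (ℓ ℕ.+ suc n) (Q (p ↑ k * B)) →
      ∀ X Y Z → p ↑ (ℓ ℕ.+ suc n) ∣ Q (p ↑ k * B) X Y - p ↑ ℓ * C * Z ^ℤ suc n →
      + p ∣ X × + p ∣ Y × + p ∣ Z
    solution-mod-↑⇒p∣all n k ℓ B C p∤C skips aniso X Y Z h with + p ∣? Z
    ... | yes p∣Z@(divides z refl) = proj₁ p∣X×p∣Y , proj₂ p∣X×p∣Y , p∣Z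
      where
      regroup : ∀ a c b w → a * c * (w * b) ≡ a * b * (c * w)
      regroup = solve-∀
      ↑∣RHS : p ↑ (ℓ ℕ.+ suc n) ∣ p ↑ ℓ * C * (z * + p) ^ℤ suc n
      ↑∣RHS = ∣-≡ (sym (begin
        p ↑ ℓ * C * (z * + p) ^ℤ suc n                ≡⟨ cong (p ↑ ℓ * C *_) (^ℤ-distribʳ-* z (+ p) (suc n)) ⟩
        p ↑ ℓ * C * (z ^ℤ suc n * (+ p) ^ℤ suc n)     ≡⟨ cong (λ t → p ↑ ℓ * C * (z ^ℤ suc n * t)) (+^ℤ≡↑ p (suc n)) ⟩
        p ↑ ℓ * C * (z ^ℤ suc n * p ↑ suc n)          ≡⟨ regroup (p ↑ ℓ) C (p ↑ suc n) (z ^ℤ suc n) ⟩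
        p ↑ ℓ * p ↑ suc n * (C * z ^ℤ suc n)          ≡⟨ cong (_* (C * z ^ℤ suc n)) (↑-+ p ℓ (suc n)) ⟨
        p ↑ (ℓ ℕ.+ suc n) * (C * z ^ℤ suc n)          ∎))
        (∣m⇒∣m*n _ ∣-refl)
        where open ≡-Reasoning
      p∣X×p∣Y : + p ∣ X × + p ∣ Y
      p∣X×p∣Y = aniso X Y (∣m-n∣n⇒∣m h ↑∣RHS)
    ... | no p∤Z = ⊥-elim ([ p∤C , p∤x⇒p∤x^n pr p∤Z (suc n) ]′ (p∣xy⇒p∣x⊎p∣y pr C (Z ^ℤ suc n) p∣CZⁿ))
      where
      R = p ↑ ℓ * C * Z ^ℤ suc n
      ↑ℓ∣R : p ↑ ℓ ∣ R
      ↑ℓ∣R = ∣m⇒∣m*n (Z ^ℤ suc n) (∣m⇒∣m*n C ∣-refl)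
      ↑suc-ℓ∣diff : p ↑ suc ℓ ∣ Q (p ↑ k * B) X Y - R
      ↑suc-ℓ∣diff = ∣-trans (↑-monoʳ-∣ p (subst (suc ℓ ≤_) (sym (ℕ.+-suc ℓ n)) (s≤s (ℕ.m≤m+n ℓ n)))) h
      ↑suc-ℓ∣Q : p ↑ suc ℓ ∣ Q (p ↑ k * B) X Y
      ↑suc-ℓ∣Q = skips X Y (∣m-n∣n⇒∣m (∣-trans (↑-monoʳ-∣ p (ℕ.m≤m+n ℓ (suc n))) h) ↑ℓ∣R)
      cancel : ∀ a r → a - (a - r) ≡ r
      cancel = solve-∀
      p∣CZⁿ : + p ∣ C * Z ^ℤ suc n
      p∣CZⁿ = ↑suc∣↑*x⇒p∣x pr ℓ (∣-≡ (trans (cancel (Q (p ↑ k * B) X Y) R) (ℤ.*-assoc (p ↑ ℓ) C (Z ^ℤ suc n)))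
                 (∣m∣n⇒∣m-n ↑suc-ℓ∣Q ↑suc-ℓ∣diff))

    no-point : ∀ n k ℓ B C → ¬ (+ p ∣ C) →
      Skips p ℓ (Q (p ↑ k * B)) → Anisotropic p (ℓ ℕ.+ suc n) (Q (p ↑ k * B)) →
      ¬ YNonempty (suc n) (p ↑ k * B) (p ↑ ℓ * C) p
    no-point n k ℓ B C p∤C skips aniso (x , y , z , solution , prim) =
      prim (map (p∣digit⇒p∣ₚ x 1≤m) (map (p∣digit⇒p∣ₚ y 1≤m) (p∣digit⇒p∣ₚ z 1≤m))
             (solution-mod-↑⇒p∣all n k ℓ B C p∤C skips aniso X Y Z atLevel))
      where
      m = ℓ ℕ.+ suc n
      X = digits x m
      Y = digits y m
      Z = digits z m
      1≤m : 1 ≤ m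
      1≤m = ℕ.≤-trans (s≤s z≤n) (ℕ.m≤n+m (suc n) ℓ)
      atLevel : p ↑ m ∣ Q (p ↑ k * B) X Y - p ↑ ℓ * C * Z ^ℤ suc n
      atLevel = ∣-≡ (cong₂ (λ a b → a + p ↑ k * B * b - p ↑ ℓ * C * Z ^ℤ suc n) (^ℤ-2 X) (^ℤ-2 Y))
                    (∣ᵤ⇒∣ (solution m))

  module _ (hn k ℓ : ℕ) (B C : ℤ) where

    private
      n = suc (hn ℕ.+ hn)

    no-point-odd-k : ∀ {p} → Prime p → ¬ (+ p ∣ B) → ¬ (+ p ∣ C) →
      Odd ℓ → Odd k → ℓ < k → k < n ℕ.+ ℓ → ¬ YNonempty n (p ↑ k * B) (p ↑ ℓ * C) p
    no-point-odd-k pr p∤B p∤C odd-ℓ odd-k ℓ<k k<n+ℓ with odd⇒≡1+j+j ℓ odd-ℓ | odd⇒≡1+j+j k odd-k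
    ... | j , refl | i , refl = no-point pr (hn ℕ.+ hn) k ℓ B C p∤C
      (Q-skips-below pr j k B ℓ<k)
      (anisotropic-mono (subst (suc k ≤_) (ℕ.+-comm n ℓ) k<n+ℓ) (Q-oddTwist-anisotropic pr B p∤B i))

    no-point-nonResidue : ∀ {p} → Prime p → ¬ (+ p ∣ C) →
      Odd ℓ → Even k → k < n ℕ.+ ℓ → ¬ (∃ λ t → t ^ℤ 2 ≡ - B [mod p ]) →
      ¬ YNonempty n (p ↑ k * B) (p ↑ ℓ * C) p
    no-point-nonResidue {p} pr p∤C odd-ℓ even-k k<n+ℓ nonRes with odd⇒≡1+j+j ℓ odd-ℓ | even⇒≡h+h k even-k
    ... | j , refl | h , refl = no-point pr (hn ℕ.+ hn) k ℓ B C p∤C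
      (Q-twist-skips p ℓ B h (anisotropic⇒skips-odd pr B aniso j))
      (anisotropic-mono (subst (suc k ≤_) (ℕ.+-comm n ℓ) k<n+ℓ) (Q-twist-anisotropic pr B 1 aniso h))
      where
      aniso : Anisotropic p 1 (Q B)
      aniso = nonResidue⇒anisotropic pr B nonRes

    no-point-2-k<ℓ : ¬ (+ 2 ∣ C) → 3 ≤ n →
      Odd ℓ → Even k → k < ℓ → + 8 ∣ B - + 3 → ¬ YNonempty n (2 ↑ k * B) (2 ↑ ℓ * C) 2
    no-point-2-k<ℓ 2∤C 3≤n odd-ℓ even-k k<ℓ B≡3 with odd⇒≡1+j+j ℓ odd-ℓ | even⇒≡h+h k even-k
    ... | j , refl | h , refl = no-point prime[2] (hn ℕ.+ hn) k ℓ B C 2∤C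
      (Q-twist-skips 2 ℓ B h (≡3[8]⇒skips-odd B B≡3 j))
      (anisotropic-mono (subst (3 ℕ.+ k ≤_) (ℕ.+-comm n ℓ) (ℕ.+-mono-≤ 3≤n (ℕ.<⇒≤ k<ℓ)))
        (Q-twist-anisotropic prime[2] B 3 (mod8-anisotropic B (+ 3) 3 (s≤s z≤n) ℕ.≤-refl B≡3 (¬∣ 2 3) (¬∣ 8 4)) h))

    no-point-2-ℓ<k : ¬ (+ 2 ∣ C) →
      Odd ℓ → Even k → ℓ < k → k < (n ℕ.+ ℓ) ∸ 2 →
      ∀ r → + 8 ∣ B - r → ¬ (+ 2 ∣ r) → ¬ (+ 8 ∣ + 1 + r) → ¬ YNonempty n (2 ↑ k * B) (2 ↑ ℓ * C) 2
    no-point-2-ℓ<k 2∤C odd-ℓ even-k ℓ<k k<n+ℓ-2 r B≡r 2∤r 8∤1+r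
      with odd⇒≡1+j+j ℓ odd-ℓ | even⇒≡h+h k even-k
    ... | j , refl | h , refl = no-point prime[2] (hn ℕ.+ hn) k ℓ B C 2∤C
      (Q-skips-below prime[2] j k B ℓ<k)
      (anisotropic-mono 3+k≤ℓ+n (Q-twist-anisotropic prime[2] B 3 (mod8-anisotropic B r 3 (s≤s z≤n) ℕ.≤-refl B≡r 2∤r 8∤1+r) h))
      where
      3+k≤ℓ+n : 3 ℕ.+ k ≤ ℓ ℕ.+ n
      3+k≤ℓ+n = subst₂ _≤_ (ℕ.+-comm (suc k) 2) (ℕ.+-comm n ℓ)
        (ℕ.m≤o∸n⇒m+n≤o (suc k) (ℕ.+-mono-≤ {1} {n} (s≤s z≤n) (s≤s z≤n)) k<n+ℓ-2)

    no-point-2-k≡n+ℓ-2 : ¬ (+ 2 ∣ C) → 3 ≤ n →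
      Odd ℓ → k ≡ (n ℕ.+ ℓ) ∸ 2 →
      ∀ r → + 8 ∣ B - r → ¬ (+ 2 ∣ r) → ¬ (+ 4 ∣ + 1 + r) → ¬ YNonempty n (2 ↑ k * B) (2 ↑ ℓ * C) 2
    no-point-2-k≡n+ℓ-2 2∤C 3≤n odd-ℓ refl r B≡r 2∤r 4∤1+r with odd⇒≡1+j+j ℓ odd-ℓ
    ... | j , refl = no-point prime[2] (hn ℕ.+ hn) k ℓ B C 2∤C
      (subst (λ k → Skips 2 ℓ (Q (2 ↑ k * B))) (sym k≡h+h) (Q-skips-below prime[2] j (h ℕ.+ h) B ℓ<h+h))
      (subst₂ (λ e k → Anisotropic 2 e (Q (2 ↑ k * B))) 2+h+h≡ℓ+n (sym k≡h+h)
        (Q-twist-anisotropic prime[2] B 2 (mod8-anisotropic B r 2 (s≤s z≤n) (s≤s (s≤s z≤n)) B≡r 2∤r 4∤1+r) h))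
      where
      h = hn ℕ.+ j
      regroup : ∀ hn j → suc (hn ℕ.+ hn) ℕ.+ suc (j ℕ.+ j) ≡ 2 ℕ.+ ((hn ℕ.+ j) ℕ.+ (hn ℕ.+ j))
      regroup = ℕ-Solver.solve-∀
      k≡h+h : (n ℕ.+ ℓ) ∸ 2 ≡ h ℕ.+ h
      k≡h+h = cong (_∸ 2) (regroup hn j)
      2+h+h≡ℓ+n : 2 ℕ.+ (h ℕ.+ h) ≡ ℓ ℕ.+ n
      2+h+h≡ℓ+n = trans (sym (regroup hn j)) (ℕ.+-comm n ℓ)
      reorder : ∀ hn j → (hn ℕ.+ hn) ℕ.+ (j ℕ.+ j) ≡ (hn ℕ.+ j) ℕ.+ (hn ℕ.+ j)
      reorder = ℕ-Solver.solve-∀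
      ℓ<h+h : ℓ < h ℕ.+ h
      ℓ<h+h = subst (suc ℓ ≤_) (reorder hn j) (ℕ.+-monoˡ-≤ (j ℕ.+ j) (ℕ.≤-pred 3≤n))

  -- Construction of points

  record SquareRoot (p : ℕ) (a : ℤ) : Set where
    field
      root          : ℕ → ℤ
      root-coherent : ∀ m → p ↑ m ∣ root (suc m) - root m
      root²≡a       : ∀ m → p ↑ m ∣ root m * root m - a

  const : ∀ {p} → ℤ → ℤ[ p ]
  const {p} c = mkℤp (λ _ → c) (λ m → ∣⇒∣ᵤ (∣-≡ (sym (ℤ.+-inverseʳ c)) (∣0 (p ↑ m))))

  point-from-sqrt : ∀ p n B C j Y Z a → SquareRoot p a →
    p ↑ (j ℕ.+ j) * a + B * (Y * Y) ≡ C * Z ^ℤ n → ¬ (+ p ∣ Y) ⊎ ¬ (+ p ∣ Z) → YNonempty n B C p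
  point-from-sqrt p n B C j Y Z a sqrt identity unit =
    x , const Y , const Z , solves ,
    λ (_ , p∣Y , p∣Z) → [ (λ p∤Y → p∤Y (∣ᵤ⇒∣ p∣Y)) , (λ p∤Z → p∤Z (∣ᵤ⇒∣ p∣Z)) ]′ unit
    where
    open SquareRoot sqrt
    x : ℤ[ p ]
    x = mkℤp (λ m → p ↑ j * root m) (λ m → ∣⇒∣ᵤ (∣-≡ (distrib (p ↑ j) (root (suc m)) (root m))
                                                   (∣n⇒∣m*n (p ↑ j) (root-coherent m))))
      where
      distrib : ∀ c a b → c * (a - b) ≡ c * a - c * b
      distrib = solve-∀
    regroup : ∀ c x a B y R → c * c * a + B * (y * y) ≡ R → c * x * (c * x) + B * (y * y) - R ≡ c * c * (x * x - a)
    regroup c x a B y R refl = expand c x a B y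
      where
      expand : ∀ c x a B y → c * x * (c * x) + B * (y * y) - (c * c * a + B * (y * y)) ≡ c * c * (x * x - a)
      expand = solve-∀
    error : ∀ m → (p ↑ j * root m) ^ℤ 2 + B * Y ^ℤ 2 - C * Z ^ℤ n ≡ p ↑ (j ℕ.+ j) * (root m * root m - a)
    error m = begin
      (p ↑ j * root m) ^ℤ 2 + B * Y ^ℤ 2 - C * Z ^ℤ n
        ≡⟨ cong₂ (λ u v → u + B * v - C * Z ^ℤ n) (^ℤ-2 (p ↑ j * root m)) (^ℤ-2 Y) ⟩
      p ↑ j * root m * (p ↑ j * root m) + B * (Y * Y) - C * Z ^ℤ n
        ≡⟨ regroup (p ↑ j) (root m) a B Y _ (trans (cong (λ t → t * a + B * (Y * Y)) (sym (↑-+ p j j))) identity) ⟩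
      p ↑ j * p ↑ j * (root m * root m - a)
        ≡⟨ cong (_* (root m * root m - a)) (↑-+ p j j) ⟨
      p ↑ (j ℕ.+ j) * (root m * root m - a)
        ∎
      where open ≡-Reasoning
    solves : SatisfiesEq n B C p x (const Y) (const Z)
    solves m = ∣⇒∣ᵤ (∣-≡ (sym (error m)) (∣n⇒∣m*n (p ↑ (j ℕ.+ j)) (root²≡a m)))

  point-from-solution : ∀ p n B C X Y Z → X * X + B * (Y * Y) ≡ C * Z ^ℤ n →
    ¬ (+ p ∣ Y) ⊎ ¬ (+ p ∣ Z) → YNonempty n B C p
  point-from-solution p n B C X Y Z solution =
    point-from-sqrt p n B C 0 Y Z (X * X) exact (trans (cong (_+ B * (Y * Y)) (ℤ.*-identityˡ (X * X))) solution)
    where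
    exact : SquareRoot p (X * X)
    exact = record
      { root          = λ _ → X
      ; root-coherent = λ m → ∣-≡ (sym (ℤ.+-inverseʳ X)) (∣0 _)
      ; root²≡a       = λ m → ∣-≡ (sym (ℤ.+-inverseʳ (X * X))) (∣0 _)
      }

  -- Hensel lifting, by Newton's step X ↦ X - (X² - a)/(2X) with 1/(2X) replaced by an inverse of 2t mod p.
  module _ {p : ℕ} (pr : Prime p) (p≢2 : p ≢ 2) where

    hensel-odd : ∀ a t → + p ∣ t * t - a → ¬ (+ p ∣ t) → SquareRoot p a
    hensel-odd a t p∣t²-a p∤t = record
      { root          = λ m → proj₁ (lift m)
      ; root-coherent = λ m → ∣-≡ (shift (proj₁ (lift m)) (correction {m} (lift m)) (p ↑ suc m))
                                  (∣n⇒∣m*n (correction {m} (lift m)) (↑-monoʳ-∣ p (ℕ.n≤1+n m)))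
      ; root²≡a       = λ m → ∣-trans (↑-monoʳ-∣ p (ℕ.n≤1+n m)) (proj₂ (proj₂ (lift m)))
      }
      where
      p∤2t : ¬ (+ p ∣ + 2 * t)
      p∤2t p∣2t = [ (λ p∣2 → p≢2 (ℕ.≤-antisym (ℕ.∣⇒≤ (∣⇒∣ᵤ p∣2)) (2≤p pr))) , p∤t ]′
                    (p∣xy⇒p∣x⊎p∣y pr (+ 2) t p∣2t)
        where
        2≤p : ∀ {p} → Prime p → 2 ≤ p
        2≤p {0}             pr = ⊥-elim (¬prime[0] pr)
        2≤p {1}             pr = ⊥-elim (¬prime[1] pr)
        2≤p {suc (suc _)} _  = s≤s (s≤s z≤n)

      u : ℤ
      u = proj₁ (∃-inverse pr (+ 2 * t) p∤2t)

      p∣2tu-1 : + p ∣ u * (+ 2 * t) - + 1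
      p∣2tu-1 = proj₂ (∃-inverse pr (+ 2 * t) p∤2t)

      Approx : ℕ → Set
      Approx m = ∃ λ X → + p ∣ X - t × p ↑ suc m ∣ X * X - a

      correction : ∀ {m} → Approx m → ℤ
      correction (_ , _ , divides q _) = - (q * u)

      step : ∀ {m} → Approx m → Approx (suc m)
      step {m} A@(X , p∣X-t , divides q X²-a≡) = X + s * M , p∣X′-t , ↑∣X′²-a
        where
        M = p ↑ suc m
        s = correction {m} A
        p∣X′-t : + p ∣ X + s * M - t
        p∣X′-t = ∣-≡ (regroup X s M t) (∣m∣n⇒∣m+n p∣X-t (∣n⇒∣m*n s (p∣↑ p {suc m} (s≤s z≤n))))
          where
          regroup : ∀ X s M t → X - t + s * M ≡ X + s * M - t
          regroup = solve-∀
        K = - q * ((u * (+ 2 * t) - + 1) + + 2 * u * (X - t)) + s * s * M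
        X′²-a≡ : (X + s * M) * (X + s * M) - a ≡ M * K
        X′²-a≡ = trans (expand X s M a) (trans (cong (λ z → z + M * (+ 2 * s * X + s * s * M)) X²-a≡) (collect q M u X t))
          where
          expand : ∀ X s M a → (X + s * M) * (X + s * M) - a ≡ (X * X - a) + M * (+ 2 * s * X + s * s * M)
          expand = solve-∀
          collect : ∀ q M u X t → q * M + M * (+ 2 * (- (q * u)) * X + (- (q * u)) * (- (q * u)) * M)
                                  ≡ M * (- q * ((u * (+ 2 * t) - + 1) + + 2 * u * (X - t)) + (- (q * u)) * (- (q * u)) * M)
          collect = solve-∀
        p∣K : + p ∣ K
        p∣K = ∣m∣n⇒∣m+n (∣n⇒∣m*n (- q) (∣m∣n⇒∣m+n p∣2tu-1 (∣n⇒∣m*n (+ 2 * u) p∣X-t)))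
                        (∣n⇒∣m*n (s * s) (p∣↑ p {suc m} (s≤s z≤n)))
        ↑∣X′²-a : p ↑ suc (suc m) ∣ (X + s * M) * (X + s * M) - a
        ↑∣X′²-a = subst₂ _∣_ (trans (ℤ.*-comm M (+ p)) (sym (↑-suc p (suc m)))) (sym X′²-a≡) (∣-* (∣-refl {M}) p∣K)

      lift : ∀ m → Approx m
      lift zero    = t , ∣-≡ (sym (ℤ.+-inverseʳ t)) (∣0 _) , subst (_∣ t * t - a) (sym (↑-1 p)) p∣t²-a
      lift (suc m) = step {m} (lift m)

      shift : ∀ X s M → s * M ≡ X + s * M - X
      shift = solve-∀

  hensel-2 : ∀ a → + 8 ∣ a - + 1 → SquareRoot 2 a
  hensel-2 a 8∣a-1 = record
    { root          = λ m → proj₁ (lift m)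
    ; root-coherent = λ m → ∣-≡ (shift (proj₁ (lift m)) (correction {m} (lift m)) (2 ↑ (2 ℕ.+ m)))
                                (∣n⇒∣m*n (correction {m} (lift m)) (↑-monoʳ-∣ 2 (ℕ.m≤n+m m 2)))
    ; root²≡a       = λ m → ∣-trans (↑-monoʳ-∣ 2 (ℕ.m≤n+m m 3)) (proj₂ (proj₂ (lift m)))
    }
    where
    Approx : ℕ → Set
    Approx m = ∃ λ X → + 2 ∣ X - + 1 × 2 ↑ (3 ℕ.+ m) ∣ X * X - a

    correction : ∀ {m} → Approx m → ℤ
    correction (_ , _ , divides q _) = q

    step : ∀ {m} → Approx m → Approx (suc m)
    step {m} (X , 2∣X-1 , divides q X²-a≡) = X + q * M , 2∣X′-1 , ↑∣X′²-a
      where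
      M = 2 ↑ (2 ℕ.+ m)
      4∣Q : + 4 ∣ M
      4∣Q = ↑-monoʳ-∣ 2 {2} {2 ℕ.+ m} (s≤s (s≤s z≤n))
      2∣X′-1 : + 2 ∣ X + q * M - + 1
      2∣X′-1 = ∣-≡ (regroup X q M) (∣m∣n⇒∣m+n 2∣X-1 (∣n⇒∣m*n q (∣-trans (divides (+ 2) refl) 4∣Q)))
        where
        regroup : ∀ X s M → X - + 1 + s * M ≡ X + s * M - + 1
        regroup = solve-∀
      K = q * (+ 2 * ((X - + 1) + + 2)) + q * q * M
      X′²-a≡ : (X + q * M) * (X + q * M) - a ≡ M * K
      X′²-a≡ = trans (expand X q M a)
        (trans (cong (λ z → z + M * (+ 2 * q * X + q * q * M)) (trans X²-a≡ (cong (q *_) (↑-suc 2 (2 ℕ.+ m)))))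
               (collect q M X))
        where
        expand : ∀ X s M a → (X + s * M) * (X + s * M) - a ≡ (X * X - a) + M * (+ 2 * s * X + s * s * M)
        expand = solve-∀
        collect : ∀ q M X → q * (+ 2 * M) + M * (+ 2 * q * X + q * q * M) ≡ M * (q * (+ 2 * ((X - + 1) + + 2)) + q * q * M)
        collect = solve-∀
      4∣K : + 4 ∣ K
      4∣K = ∣m∣n⇒∣m+n (∣n⇒∣m*n q (∣-* (∣-refl {+ 2}) (∣m∣n⇒∣m+n 2∣X-1 (∣-refl {+ 2})))) (∣n⇒∣m*n (q * q) 4∣Q)
      ↑∣X′²-a : 2 ↑ (3 ℕ.+ suc m) ∣ (X + q * M) * (X + q * M) - a
      ↑∣X′²-a = subst₂ _∣_ (sym (trans (cong (2 ↑_) (ℕ.+-comm 2 (2 ℕ.+ m))) (↑-+ 2 (2 ℕ.+ m) 2)))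
                           (sym X′²-a≡) (∣-* (∣-refl {M}) 4∣K)

    lift : ∀ m → Approx m
    lift zero    = + 1 , divides (+ 0) refl , ∣-≡ (negate a) (∣m⇒∣-m 8∣a-1)
      where
      negate : ∀ a → - (a - + 1) ≡ + 1 * + 1 - a
      negate = solve-∀
    lift (suc m) = step {m} (lift m)

    shift : ∀ X s M → s * M ≡ X + s * M - X
    shift = solve-∀

  module _ {p : ℕ} (pr : Prime p) (hn k ℓ : ℕ) (B C : ℤ) (p∤B : ¬ (+ p ∣ B)) (p∤C : ¬ (+ p ∣ C)) where

    private
      n = suc (hn ℕ.+ hn)
      Point = YNonempty n (p ↑ k * B) (p ↑ ℓ * C) p
      A = C ^ℤ suc hn

      Bⁿ≡B*Bʰ*Bʰ : B ^ℤ n ≡ B * (B ^ℤ hn * B ^ℤ hn)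
      Bⁿ≡B*Bʰ*Bʰ = cong (B *_) (^ℤ-distribˡ-+-* B hn hn)

    point-ℓ-even : ∀ i → ℓ ≡ i ℕ.+ i → Point
    point-ℓ-even i refl = point-from-solution p n (p ↑ k * B) (p ↑ ℓ * C) (A * p ↑ i) (+ 0) C (begin
      A * p ↑ i * (A * p ↑ i) + p ↑ k * B * (+ 0 * + 0)  ≡⟨ regroup A (p ↑ i) (p ↑ k * B) ⟩
      A * A * (p ↑ i * p ↑ i)                            ≡⟨ cong₂ _*_ (^ℤ-square C hn) (sym (↑-+ p i i)) ⟩
      C * C ^ℤ n * p ↑ ℓ                                 ≡⟨ commute C (C ^ℤ n) (p ↑ ℓ) ⟩
      p ↑ ℓ * C * C ^ℤ n                                 ∎) (inj₂ p∤C)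
      where
      open ≡-Reasoning
      regroup : ∀ A c B → A * c * (A * c) + B * (+ 0 * + 0) ≡ A * A * (c * c)
      regroup = solve-∀
      commute : ∀ c cⁿ d → c * cⁿ * d ≡ d * c * cⁿ
      commute = solve-∀

    point-ℓ-k-even : ∀ i → ℓ ≡ k ℕ.+ (i ℕ.+ i) → Point
    point-ℓ-k-even i refl = point-from-solution p n (p ↑ k * B) (p ↑ ℓ * C) (+ 0) Y (B * C) (begin
      + 0 * + 0 + p ↑ k * B * (Y * Y)                      ≡⟨ regroup (p ↑ k) B (p ↑ i) (B ^ℤ hn) A ⟩
      p ↑ k * (p ↑ i * p ↑ i) * (B * (B ^ℤ hn * B ^ℤ hn)) * (A * A)
        ≡⟨ cong₂ (λ u v → u * v * (A * A)) (trans (cong (p ↑ k *_) (sym (↑-+ p i i))) (sym (↑-+ p k (i ℕ.+ i))))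
                                            (sym Bⁿ≡B*Bʰ*Bʰ) ⟩
      p ↑ ℓ * B ^ℤ n * (A * A)                             ≡⟨ cong (p ↑ ℓ * B ^ℤ n *_) (^ℤ-square C hn) ⟩
      p ↑ ℓ * B ^ℤ n * (C * C ^ℤ n)                        ≡⟨ commute (p ↑ ℓ) (B ^ℤ n) C (C ^ℤ n) ⟩
      p ↑ ℓ * C * (B ^ℤ n * C ^ℤ n)                        ≡⟨ cong (p ↑ ℓ * C *_) (^ℤ-distribʳ-* B C n) ⟨
      p ↑ ℓ * C * (B * C) ^ℤ n                             ∎) (inj₂ (p∤x⇒p∤y⇒p∤xy pr p∤B p∤C))
      where
      open ≡-Reasoning
      Y = p ↑ i * (B ^ℤ hn * A)
      regroup : ∀ c B d Bʰ A → + 0 * + 0 + c * B * (d * (Bʰ * A) * (d * (Bʰ * A))) ≡ c * (d * d) * (B * (Bʰ * Bʰ)) * (A * A)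
      regroup = solve-∀
      commute : ∀ c Bⁿ C Cⁿ → c * Bⁿ * (C * Cⁿ) ≡ c * C * (Bⁿ * Cⁿ)
      commute = solve-∀

    point-k≡ℓ+n : k ≡ ℓ ℕ.+ n → Point
    point-k≡ℓ+n refl = point-from-solution p n (p ↑ k * B) (p ↑ ℓ * C) (+ 0) (B ^ℤ hn * A) (+ p * (B * C)) (begin
      + 0 * + 0 + p ↑ k * B * (B ^ℤ hn * A * (B ^ℤ hn * A))   ≡⟨ regroup (p ↑ k) B (B ^ℤ hn) A ⟩
      p ↑ k * (B * (B ^ℤ hn * B ^ℤ hn)) * (A * A)
        ≡⟨ cong₂ (λ u v → u * v * (A * A)) (↑-+ p ℓ n) (sym Bⁿ≡B*Bʰ*Bʰ) ⟩
      p ↑ ℓ * p ↑ n * B ^ℤ n * (A * A)                         ≡⟨ cong (p ↑ ℓ * p ↑ n * B ^ℤ n *_) (^ℤ-square C hn) ⟩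
      p ↑ ℓ * p ↑ n * B ^ℤ n * (C * C ^ℤ n)                    ≡⟨ commute (p ↑ ℓ) (p ↑ n) (B ^ℤ n) C (C ^ℤ n) ⟩
      p ↑ ℓ * C * (p ↑ n * (B ^ℤ n * C ^ℤ n))
        ≡⟨ cong (p ↑ ℓ * C *_) (sym (trans (^ℤ-distribʳ-* (+ p) (B * C) n) (cong₂ _*_ (+^ℤ≡↑ p n) (^ℤ-distribʳ-* B C n)))) ⟩
      p ↑ ℓ * C * (+ p * (B * C)) ^ℤ n                         ∎)
      (inj₁ (p∤x⇒p∤y⇒p∤xy pr (p∤x⇒p∤x^n pr p∤B hn) (p∤x⇒p∤x^n pr p∤C (suc hn))))
      where
      open ≡-Reasoning
      regroup : ∀ c B Bʰ A → + 0 * + 0 + c * B * (Bʰ * A * (Bʰ * A)) ≡ c * (B * (Bʰ * Bʰ)) * (A * A)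
      regroup = solve-∀
      commute : ∀ c d Bⁿ C Cⁿ → c * d * Bⁿ * (C * Cⁿ) ≡ c * C * (d * (Bⁿ * Cⁿ))
      commute = solve-∀

    -- C (C w)ⁿ with w ≡ 1 (mod p) is congruent to the square A² = Cⁿ⁺¹ of a unit.
    sqrt-shifted : ∀ e → 1 ≤ e → SquareRoot p (C * (C * (+ 1 + p ↑ e * B)) ^ℤ n - p ↑ e * B)
    sqrt-shifted e 1≤e with p ℕ.≟ 2
    ... | no p≢2 = hensel-odd pr p≢2 _ A p∣A²-a (p∤x⇒p∤x^n pr p∤C (suc hn))
      where
      Cw = C * (+ 1 + p ↑ e * B)
      split : ∀ C x → C * (+ 1 + x) - C ≡ C * x
      split = solve-∀
      p∣Cwⁿ-Cⁿ : + p ∣ Cw ^ℤ n - C ^ℤ n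
      p∣Cwⁿ-Cⁿ = ∣-^ℤ Cw C n (∣-≡ (sym (split C (p ↑ e * B))) (∣n⇒∣m*n C (∣m⇒∣m*n B (p∣↑ p 1≤e))))
      regroup : ∀ C Cⁿ Cwⁿ pᵉB → C * Cⁿ - (C * Cwⁿ - pᵉB) ≡ pᵉB - C * (Cwⁿ - Cⁿ)
      regroup = solve-∀
      p∣A²-a : + p ∣ A * A - (C * Cw ^ℤ n - p ↑ e * B)
      p∣A²-a = ∣-≡ (sym (trans (cong (_- (C * Cw ^ℤ n - p ↑ e * B)) (^ℤ-square C hn)) (regroup C (C ^ℤ n) (Cw ^ℤ n) (p ↑ e * B))))
                   (∣m∣n⇒∣m-n (∣m⇒∣m*n B (p∣↑ p 1≤e)) (∣n⇒∣m*n C p∣Cwⁿ-Cⁿ))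
    ... | yes refl = hensel-2 _ 8∣a-1
      where
      w = + 1 + 2 ↑ e * B
      2∤w : ¬ (+ 2 ∣ w)
      2∤w = 2∣x-1⇒2∤x w (∣-≡ (sym (cancel (2 ↑ e * B))) (∣m⇒∣m*n B (p∣↑ 2 1≤e)))
        where
        cancel : ∀ x → + 1 + x - + 1 ≡ x
        cancel = solve-∀
      regroup : ∀ C Cⁿ wⁿ x → C * (Cⁿ * wⁿ) - x - + 1 ≡ C * Cⁿ * wⁿ - x - + 1
      regroup = solve-∀
      split : ∀ A² wⁿ x → A² * wⁿ - x - + 1 ≡ (A² - + 1) * wⁿ + (wⁿ - (+ 1 + x))
      split = solve-∀
      8∣a-1 : + 8 ∣ C * (C * w) ^ℤ n - 2 ↑ e * B - + 1
      8∣a-1 = ∣-≡ (sym (begin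
        C * (C * w) ^ℤ n - 2 ↑ e * B - + 1          ≡⟨ cong (λ u → C * u - 2 ↑ e * B - + 1) (^ℤ-distribʳ-* C w n) ⟩
        C * (C ^ℤ n * w ^ℤ n) - 2 ↑ e * B - + 1     ≡⟨ regroup C (C ^ℤ n) (w ^ℤ n) (2 ↑ e * B) ⟩
        C * C ^ℤ n * w ^ℤ n - 2 ↑ e * B - + 1       ≡⟨ cong (λ u → u * w ^ℤ n - 2 ↑ e * B - + 1) (^ℤ-square C hn) ⟨
        A * A * w ^ℤ n - 2 ↑ e * B - + 1            ≡⟨ split (A * A) (w ^ℤ n) (2 ↑ e * B) ⟩
        (A * A - + 1) * w ^ℤ n + (w ^ℤ n - w)       ∎))
        (∣m∣n⇒∣m+n (∣m⇒∣m*n (w ^ℤ n) (odd⇒8∣x²-1 A (p∤x⇒p∤x^n prime[2] p∤C (suc hn)))) (odd⇒8∣x^odd-x w 2∤w hn))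
        where open ≡-Reasoning

    -- [p^j √a : 1 : p C w] with w = 1 + pᵉ B and a = C (C w)ⁿ - pᵉ B.
    point-k>ℓ+n : ∀ j e → 1 ≤ e → ℓ ℕ.+ n ≡ j ℕ.+ j → k ≡ ℓ ℕ.+ n ℕ.+ e → Point
    point-k>ℓ+n j e 1≤e ℓ+n≡j+j refl =
      point-from-sqrt p n (p ↑ k * B) (p ↑ ℓ * C) j (+ 1) (+ p * Cw) a (sqrt-shifted e 1≤e) (begin
        p ↑ (j ℕ.+ j) * a + p ↑ k * B * (+ 1 * + 1)
          ≡⟨ cong₂ (λ u v → u * a + v * B * (+ 1 * + 1))
                   (trans (cong (p ↑_) (sym ℓ+n≡j+j)) (↑-+ p ℓ n))
                   (trans (↑-+ p (ℓ ℕ.+ n) e) (cong (_* p ↑ e) (↑-+ p ℓ n))) ⟩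
        p ↑ ℓ * p ↑ n * a + p ↑ ℓ * p ↑ n * p ↑ e * B * (+ 1 * + 1)
          ≡⟨ cancel (p ↑ ℓ) (p ↑ n) (p ↑ e) C (Cw ^ℤ n) B ⟩
        p ↑ ℓ * C * (p ↑ n * Cw ^ℤ n)
          ≡⟨ cong (p ↑ ℓ * C *_) (sym (trans (^ℤ-distribʳ-* (+ p) Cw n) (cong (_* Cw ^ℤ n) (+^ℤ≡↑ p n)))) ⟩
        p ↑ ℓ * C * (+ p * Cw) ^ℤ n ∎)
      (inj₁ (p∤1 pr))
      where
      open ≡-Reasoning
      Cw = C * (+ 1 + p ↑ e * B)
      a = C * Cw ^ℤ n - p ↑ e * B
      cancel : ∀ c d pᵉ C Cwⁿ B → c * d * (C * Cwⁿ - pᵉ * B) + c * d * pᵉ * B * (+ 1 * + 1) ≡ c * C * (d * Cwⁿ)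
      cancel = solve-∀

    -- [p^h √a : 1 : p^c] with a = p^f C - B.
    point-k-even : ∀ h c f → k ≡ h ℕ.+ h → k ℕ.+ f ≡ ℓ ℕ.+ c ℕ.* n → SquareRoot p (p ↑ f * C - B) → Point
    point-k-even h c f refl k+f≡ℓ+cn sqrt =
      point-from-sqrt p n (p ↑ k * B) (p ↑ ℓ * C) h (+ 1) (p ↑ c) (p ↑ f * C - B) sqrt (begin
        p ↑ k * (p ↑ f * C - B) + p ↑ k * B * (+ 1 * + 1)   ≡⟨ cancel (p ↑ k) (p ↑ f) C B ⟩
        p ↑ k * p ↑ f * C                                   ≡⟨ cong (_* C) (sym (↑-+ p k f)) ⟩
        p ↑ (k ℕ.+ f) * C                                   ≡⟨ cong (λ m → p ↑ m * C) k+f≡ℓ+cn ⟩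
        p ↑ (ℓ ℕ.+ c ℕ.* n) * C                             ≡⟨ cong (_* C) (↑-+ p ℓ (c ℕ.* n)) ⟩
        p ↑ ℓ * p ↑ (c ℕ.* n) * C                           ≡⟨ commute (p ↑ ℓ) (p ↑ (c ℕ.* n)) C ⟩
        p ↑ ℓ * C * p ↑ (c ℕ.* n)                           ≡⟨ cong (p ↑ ℓ * C *_) (↑-^ℤ p c n) ⟨
        p ↑ ℓ * C * (p ↑ c) ^ℤ n                            ∎)
      (inj₁ (p∤1 pr))
      where
      open ≡-Reasoning
      cancel : ∀ c d C B → c * (d * C - B) + c * B * (+ 1 * + 1) ≡ c * d * C
      cancel = solve-∀
      commute : ∀ c d C → c * d * C ≡ c * C * d
      commute = solve-∀

  -- [2^j √a : 2^(j-h) : C b] with a = 2 C (C b)ⁿ - B, where B = 2b - 1.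
  point-2-k<ℓ : ∀ hn k ℓ B C → ¬ (+ 2 ∣ C) → ∀ j h → ℓ ≡ suc (j ℕ.+ j) → k ≡ h ℕ.+ h → h ≤ j →
    + 4 ∣ B - + 1 → YNonempty (suc (hn ℕ.+ hn)) (2 ↑ k * B) (2 ↑ ℓ * C) 2
  point-2-k<ℓ hn k ℓ B C 2∤C j h refl refl h≤j 4∣B-1 with 4∣B-1⇒B≡2b-1 B 4∣B-1
  ... | b , refl , 2∤b =
    point-from-sqrt 2 n (2 ↑ k * B) (2 ↑ ℓ * C) j (2 ↑ d) Z a (hensel-2 a 8∣a-1) (begin
      2 ↑ (j ℕ.+ j) * a + 2 ↑ k * B * (2 ↑ d * 2 ↑ d)
        ≡⟨ cong (λ u → 2 ↑ (j ℕ.+ j) * a + u) (regroup (2 ↑ k) B (2 ↑ d * 2 ↑ d)) ⟩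
      2 ↑ (j ℕ.+ j) * a + 2 ↑ k * (2 ↑ d * 2 ↑ d) * B
        ≡⟨ cong (λ u → 2 ↑ (j ℕ.+ j) * a + u * B) 2ᵏ⁺²ᵈ≡2²ʲ ⟩
      2 ↑ (j ℕ.+ j) * a + 2 ↑ (j ℕ.+ j) * B
        ≡⟨ cancel (2 ↑ (j ℕ.+ j)) C (Z ^ℤ n) B ⟩
      2 ↑ (j ℕ.+ j) * + 2 * C * Z ^ℤ n
        ≡⟨ cong (λ u → u * C * Z ^ℤ n) (trans (sym (↑-+ 2 (j ℕ.+ j) 1)) (cong (2 ↑_) (ℕ.+-comm (j ℕ.+ j) 1))) ⟩
      2 ↑ suc (j ℕ.+ j) * C * Z ^ℤ n
        ∎)
    (inj₂ 2∤Z)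
    where
    open ≡-Reasoning
    n = suc (hn ℕ.+ hn)
    d = j ∸ h
    Z = C * b
    a = + 2 * C * Z ^ℤ n - (b + b - + 1)
    2∤Z : ¬ (+ 2 ∣ Z)
    2∤Z = p∤x⇒p∤y⇒p∤xy prime[2] 2∤C 2∤b
    split : ∀ C b Zⁿ → + 2 * C * Zⁿ - (b + b - + 1) - + 1 ≡ + 2 * C * (Zⁿ - C * b) + + 2 * b * (C * C - + 1)
    split = solve-∀
    8∣a-1 : + 8 ∣ a - + 1
    8∣a-1 = ∣-≡ (sym (split C b (Z ^ℤ n)))
      (∣m∣n⇒∣m+n (∣n⇒∣m*n (+ 2 * C) (odd⇒8∣x^odd-x Z 2∤Z hn)) (∣n⇒∣m*n (+ 2 * b) (odd⇒8∣x²-1 C 2∤C)))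
    regroup : ∀ c B e → c * B * e ≡ c * e * B
    regroup = solve-∀
    cancel : ∀ c C Zⁿ B → c * (+ 2 * C * Zⁿ - B) + c * B ≡ c * + 2 * C * Zⁿ
    cancel = solve-∀
    double : ∀ h d → h ℕ.+ h ℕ.+ (d ℕ.+ d) ≡ (h ℕ.+ d) ℕ.+ (h ℕ.+ d)
    double = ℕ-Solver.solve-∀
    2ᵏ⁺²ᵈ≡2²ʲ : 2 ↑ (h ℕ.+ h) * (2 ↑ d * 2 ↑ d) ≡ 2 ↑ (j ℕ.+ j)
    2ᵏ⁺²ᵈ≡2²ʲ = begin
      2 ↑ (h ℕ.+ h) * (2 ↑ d * 2 ↑ d)   ≡⟨ cong (2 ↑ (h ℕ.+ h) *_) (↑-+ 2 d d) ⟨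
      2 ↑ (h ℕ.+ h) * 2 ↑ (d ℕ.+ d)     ≡⟨ ↑-+ 2 (h ℕ.+ h) (d ℕ.+ d) ⟨
      2 ↑ (h ℕ.+ h ℕ.+ (d ℕ.+ d))       ≡⟨ cong (2 ↑_) (trans (double h d) (cong (λ x → x ℕ.+ x) (ℕ.m+[n∸m]≡n h≤j))) ⟩
      2 ↑ (j ℕ.+ j)                     ∎

  -- The case analysis

  Condition : ℕ → ℕ → ℕ → ℕ → ℤ → Set
  Condition n p k ℓ B = Odd ℓ ×
    ((Odd k × ℓ < k × k < n ℕ.+ ℓ)
    ⊎ (p ≢ 2 × Even k × k < n ℕ.+ ℓ × LegendreMinusOne (- B) p)
    ⊎ (p ≡ 2 × Even k × k < ℓ × (B ≡ + 3 [mod 8 ]))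
    ⊎ (p ≡ 2 × Even k × ℓ < k × k < (n ℕ.+ ℓ) ∸ 2
        × ((B ≡ + 1 [mod 8 ]) ⊎ (B ≡ + 3 [mod 8 ]) ⊎ (B ≡ + 5 [mod 8 ])))
    ⊎ (p ≡ 2 × k ≡ (n ℕ.+ ℓ) ∸ 2 × ((B ≡ + 1 [mod 8 ]) ⊎ (B ≡ + 5 [mod 8 ]))))

  pattern case-i   c = inj₁ c
  pattern case-ii  c = inj₂ (inj₁ c)
  pattern case-iii c = inj₂ (inj₂ (inj₁ c))
  pattern case-iv  c = inj₂ (inj₂ (inj₂ (inj₁ c)))
  pattern case-v   c = inj₂ (inj₂ (inj₂ (inj₂ c)))

  condition⇒no-point : ∀ hn → 3 ≤ suc (hn ℕ.+ hn) → ∀ {p} → Prime p → ∀ k ℓ B C → ¬ (+ p ∣ B) → ¬ (+ p ∣ C) →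
    Condition (suc (hn ℕ.+ hn)) p k ℓ B → ¬ YNonempty (suc (hn ℕ.+ hn)) (p ↑ k * B) (p ↑ ℓ * C) p
  condition⇒no-point hn 3≤n pr k ℓ B C p∤B p∤C (odd-ℓ , c) with c
  ... | case-i (odd-k , ℓ<k , k<n+ℓ) =
    no-point-odd-k hn k ℓ B C pr p∤B p∤C odd-ℓ odd-k ℓ<k k<n+ℓ
  ... | case-ii (_ , even-k , k<n+ℓ , _ , nonRes) =
    no-point-nonResidue hn k ℓ B C pr p∤C odd-ℓ even-k k<n+ℓ nonRes
  ... | case-iii (refl , even-k , k<ℓ , B≡3) =
    no-point-2-k<ℓ hn k ℓ B C p∤C 3≤n odd-ℓ even-k k<ℓ (∣ᵤ⇒∣ B≡3)
  ... | case-iv (refl , even-k , ℓ<k , k<n+ℓ-2 , inj₁ B≡1) =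
    no-point-2-ℓ<k hn k ℓ B C p∤C odd-ℓ even-k ℓ<k k<n+ℓ-2 (+ 1) (∣ᵤ⇒∣ B≡1) (¬∣ 2 1) (¬∣ 8 2)
  ... | case-iv (refl , even-k , ℓ<k , k<n+ℓ-2 , inj₂ (inj₁ B≡3)) =
    no-point-2-ℓ<k hn k ℓ B C p∤C odd-ℓ even-k ℓ<k k<n+ℓ-2 (+ 3) (∣ᵤ⇒∣ B≡3) (¬∣ 2 3) (¬∣ 8 4)
  ... | case-iv (refl , even-k , ℓ<k , k<n+ℓ-2 , inj₂ (inj₂ B≡5)) =
    no-point-2-ℓ<k hn k ℓ B C p∤C odd-ℓ even-k ℓ<k k<n+ℓ-2 (+ 5) (∣ᵤ⇒∣ B≡5) (¬∣ 2 5) (¬∣ 8 6)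
  ... | case-v (refl , k≡n+ℓ-2 , inj₁ B≡1) =
    no-point-2-k≡n+ℓ-2 hn k ℓ B C p∤C 3≤n odd-ℓ k≡n+ℓ-2 (+ 1) (∣ᵤ⇒∣ B≡1) (¬∣ 2 1) (¬∣ 4 2)
  ... | case-v (refl , k≡n+ℓ-2 , inj₂ B≡5) =
    no-point-2-k≡n+ℓ-2 hn k ℓ B C p∤C 3≤n odd-ℓ k≡n+ℓ-2 (+ 5) (∣ᵤ⇒∣ B≡5) (¬∣ 2 5) (¬∣ 4 6)

  module _ (hn : ℕ) (3≤n : 3 ≤ suc (hn ℕ.+ hn)) {p : ℕ} (pr : Prime p) (k ℓ : ℕ) (B C : ℤ)
           (p∤B : ¬ (+ p ∣ B)) (p∤C : ¬ (+ p ∣ C)) where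

    private
      n = suc (hn ℕ.+ hn)
      Point = YNonempty n (p ↑ k * B) (p ↑ ℓ * C) p
      Outcome = Condition n p k ℓ B ⊎ Point

      ℓ+n≡m+m : ∀ j → ℓ ≡ suc (j ℕ.+ j) → ℓ ℕ.+ n ≡ suc (j ℕ.+ hn) ℕ.+ suc (j ℕ.+ hn)
      ℓ+n≡m+m j refl = double j hn
        where
        double : ∀ j hn → suc (j ℕ.+ j) ℕ.+ suc (hn ℕ.+ hn) ≡ suc (j ℕ.+ hn) ℕ.+ suc (j ℕ.+ hn)
        double = ℕ-Solver.solve-∀

      k≥n+ℓ : ∀ j → ℓ ≡ suc (j ℕ.+ j) → ¬ (k < n ℕ.+ ℓ) → (k ≡ ℓ ℕ.+ n → Point) → Point
      k≥n+ℓ j ℓ≡ k≮n+ℓ k≡ℓ+n⇒point = by-excess (k ∸ (ℓ ℕ.+ n)) (sym (ℕ.m+[n∸m]≡n ℓ+n≤k))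
        where
        ℓ+n≤k : ℓ ℕ.+ n ≤ k
        ℓ+n≤k = subst (_≤ k) (ℕ.+-comm n ℓ) (ℕ.≮⇒≥ k≮n+ℓ)
        by-excess : ∀ e → k ≡ ℓ ℕ.+ n ℕ.+ e → Point
        by-excess zero    k≡ = k≡ℓ+n⇒point (trans k≡ (ℕ.+-identityʳ _))
        by-excess (suc e) k≡ = point-k>ℓ+n pr hn k ℓ B C p∤B p∤C (suc (j ℕ.+ hn)) (suc e) (s≤s z≤n) (ℓ+n≡m+m j ℓ≡) k≡

    odd-k : ∀ j → ℓ ≡ suc (j ℕ.+ j) → ∀ i → k ≡ suc (i ℕ.+ i) → Outcome
    odd-k j ℓ≡ i k≡ with ℕ.≤-<-connex k ℓ
    ... | inj₁ k≤ℓ with even⊎odd (ℓ ∸ k)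
    ...   | inj₁ (d , ℓ-k≡d+d) = inj₂ (point-ℓ-k-even pr hn k ℓ B C p∤B p∤C d
              (trans (sym (ℕ.m+[n∸m]≡n k≤ℓ)) (cong (k ℕ.+_) ℓ-k≡d+d)))
    ...   | inj₂ (d , ℓ-k≡1+d+d) = ⊥-elim (h+h≢1+j+j (suc (i ℕ.+ d)) j (begin
              suc (i ℕ.+ d) ℕ.+ suc (i ℕ.+ d)    ≡⟨ regroup i d ⟨
              suc (i ℕ.+ i) ℕ.+ suc (d ℕ.+ d)    ≡⟨ cong₂ ℕ._+_ k≡ ℓ-k≡1+d+d ⟨
              k ℕ.+ (ℓ ∸ k)                      ≡⟨ ℕ.m+[n∸m]≡n k≤ℓ ⟩
              ℓ                                  ≡⟨ ℓ≡ ⟩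
              suc (j ℕ.+ j)                      ∎))
      where
      open ≡-Reasoning
      regroup : ∀ i d → suc (i ℕ.+ i) ℕ.+ suc (d ℕ.+ d) ≡ suc (i ℕ.+ d) ℕ.+ suc (i ℕ.+ d)
      regroup = ℕ-Solver.solve-∀
    odd-k j ℓ≡ i k≡ | inj₂ ℓ<k with k ℕ.<? n ℕ.+ ℓ
    ... | yes k<n+ℓ = inj₁ (subst Odd (sym ℓ≡) (odd-1+j+j j) , case-i (subst Odd (sym k≡) (odd-1+j+j i) , ℓ<k , k<n+ℓ))
    ... | no  k≮n+ℓ = inj₂ (k≥n+ℓ j ℓ≡ k≮n+ℓ λ k≡ℓ+n →
            ⊥-elim (h+h≢1+j+j (suc (j ℕ.+ hn)) i (trans (sym (ℓ+n≡m+m j ℓ≡)) (trans (sym k≡ℓ+n) k≡))))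

    module _ (j : ℕ) (ℓ≡ : ℓ ≡ suc (j ℕ.+ j)) (h : ℕ) (k≡ : k ≡ h ℕ.+ h) (k<n+ℓ : k < n ℕ.+ ℓ) where

      private
        odd-ℓ : Odd ℓ
        odd-ℓ = subst Odd (sym ℓ≡) (odd-1+j+j j)

        even-k : Even k
        even-k = subst Even (sym k≡) (even-h+h h)

        f : ℕ
        f = (ℓ ℕ.+ 2 ℕ.* n) ∸ k

        ℓ+2n≡n+ℓ+n : ℓ ℕ.+ 2 ℕ.* n ≡ n ℕ.+ ℓ ℕ.+ n
        ℓ+2n≡n+ℓ+n = regroup ℓ n
          where
          regroup : ∀ ℓ n → ℓ ℕ.+ 2 ℕ.* n ≡ n ℕ.+ ℓ ℕ.+ n
          regroup = ℕ-Solver.solve-∀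

        k<ℓ+2n : k < ℓ ℕ.+ 2 ℕ.* n
        k<ℓ+2n = subst (k <_) (sym ℓ+2n≡n+ℓ+n) (ℕ.<-≤-trans k<n+ℓ (ℕ.m≤m+n (n ℕ.+ ℓ) n))

        k+f≡ℓ+2n : k ℕ.+ f ≡ ℓ ℕ.+ 2 ℕ.* n
        k+f≡ℓ+2n = ℕ.m+[n∸m]≡n (ℕ.<⇒≤ k<ℓ+2n)

        n<f : n < f
        n<f = ℕ.+-cancelˡ-< k n f (subst (k ℕ.+ n <_) (sym (trans k+f≡ℓ+2n ℓ+2n≡n+ℓ+n)) (ℕ.+-monoˡ-< n k<n+ℓ))

        ℓ≢k : ℓ ≢ k
        ℓ≢k ℓ≡k = h+h≢1+j+j h j (trans (sym k≡) (trans (sym ℓ≡k) ℓ≡))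

        m : ℕ
        m = hn ℕ.+ j

        n+ℓ≡2+m+m : n ℕ.+ ℓ ≡ 2 ℕ.+ (m ℕ.+ m)
        n+ℓ≡2+m+m = trans (cong (n ℕ.+_) ℓ≡) (regroup hn j)
          where
          regroup : ∀ hn j → suc (hn ℕ.+ hn) ℕ.+ suc (j ℕ.+ j) ≡ 2 ℕ.+ ((hn ℕ.+ j) ℕ.+ (hn ℕ.+ j))
          regroup = ℕ-Solver.solve-∀

        k≡n+ℓ-2 : ¬ (k < (n ℕ.+ ℓ) ∸ 2) → k ≡ (n ℕ.+ ℓ) ∸ 2
        k≡n+ℓ-2 k≮n+ℓ-2 = trans k≡ (trans (m+m≤h+h≤1+m+m⇒h+h≡m+m h m m+m≤h+h (ℕ.≤-pred h+h<2+m+m)) (sym n+ℓ-2≡m+m))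
          where
          n+ℓ-2≡m+m : (n ℕ.+ ℓ) ∸ 2 ≡ m ℕ.+ m
          n+ℓ-2≡m+m = cong (_∸ 2) n+ℓ≡2+m+m
          h+h<2+m+m : h ℕ.+ h < 2 ℕ.+ (m ℕ.+ m)
          h+h<2+m+m = subst₂ _<_ k≡ n+ℓ≡2+m+m k<n+ℓ
          m+m≤h+h : m ℕ.+ m ≤ h ℕ.+ h
          m+m≤h+h = subst₂ _≤_ n+ℓ-2≡m+m k≡ (ℕ.≮⇒≥ k≮n+ℓ-2)

      odd-p : p ≢ 2 → Outcome
      odd-p p≢2 with sqrt-mod? pr (- B)
      ... | inj₂ nonRes = inj₁ (odd-ℓ , case-ii (p≢2 , even-k , k<n+ℓ , p∤-B , nonRes))
        where
        p∤-B : ¬ (+ p ∣ᵤ - B)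
        p∤-B p∣-B = p∤B (∣-≡ (ℤ.neg-involutive B) (∣m⇒∣-m (∣ᵤ⇒∣ p∣-B)))
      ... | inj₁ (t , p∣t²+B) = inj₂ (point-k-even pr hn k ℓ B C p∤B p∤C h 2 f k≡ k+f≡ℓ+2n
              (hensel-odd pr p≢2 _ t p∣t²-a p∤t))
        where
        shift : ∀ t B c → t * t - (c - B) ≡ t * t - - B - c
        shift = solve-∀
        p∣t²-a : + p ∣ t * t - (p ↑ f * C - B)
        p∣t²-a = ∣-≡ (sym (shift t B (p ↑ f * C)))
                     (∣m∣n⇒∣m-n p∣t²+B (∣m⇒∣m*n C (p∣↑ p (ℕ.≤-trans (s≤s z≤n) n<f))))
        cancel : ∀ t B → t * t - - B - t * t ≡ B
        cancel = solve-∀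
        p∤t : ¬ (+ p ∣ t)
        p∤t p∣t = p∤B (∣-≡ (cancel t B) (∣m∣n⇒∣m-n p∣t²+B (∣m⇒∣m*n t p∣t)))

      private
        ℓ<k : ¬ (k < ℓ) → ℓ < k
        ℓ<k k≮ℓ = ℕ.≤∧≢⇒< (ℕ.≮⇒≥ k≮ℓ) ℓ≢k

      two-adic-3 : p ≡ 2 → + 8 ∣ B - + 3 → Outcome
      two-adic-3 refl B≡3 with k ℕ.<? ℓ
      ... | yes k<ℓ = inj₁ (odd-ℓ , case-iii (refl , even-k , k<ℓ , ∣⇒∣ᵤ B≡3))
      ... | no  k≮ℓ with k ℕ.<? (n ℕ.+ ℓ) ∸ 2
      ...   | yes k<n+ℓ-2 = inj₁ (odd-ℓ , case-iv (refl , even-k , ℓ<k k≮ℓ , k<n+ℓ-2 , inj₂ (inj₁ (∣⇒∣ᵤ B≡3))))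
      ...   | no  k≮n+ℓ-2 = inj₂ (point-k-even pr hn k ℓ B C p∤B p∤C h 1 2 k≡ k+2≡ℓ+n (hensel-2 _ 8∣4C-B-1))
        where
        k+2≡ℓ+n : k ℕ.+ 2 ≡ ℓ ℕ.+ 1 ℕ.* n
        k+2≡ℓ+n = begin
          k ℕ.+ 2                ≡⟨ cong (ℕ._+ 2) (k≡n+ℓ-2 k≮n+ℓ-2) ⟩
          (n ℕ.+ ℓ) ∸ 2 ℕ.+ 2    ≡⟨ ℕ.m∸n+n≡m (ℕ.≤-trans (ℕ.≤-trans (ℕ.n≤1+n 2) 3≤n) (ℕ.m≤m+n n ℓ)) ⟩
          n ℕ.+ ℓ                ≡⟨ ℕ.+-comm n ℓ ⟩
          ℓ ℕ.+ n                ≡⟨ cong (ℓ ℕ.+_) (ℕ.*-identityˡ n) ⟨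
          ℓ ℕ.+ 1 ℕ.* n          ∎
          where open ≡-Reasoning
        8∣4C-B-1 : + 8 ∣ + 4 * C - B - + 1
        8∣4C-B-1 with parity C
        ... | even q C≡ = ⊥-elim (p∤C (divides q C≡))
        ... | odd  q refl = ∣-≡ (sym (regroup q B)) (∣m∣n⇒∣m-n (∣n⇒∣m*n q ∣-refl) B≡3)
          where
          regroup : ∀ q B → + 4 * (q * + 2 + + 1) - B - + 1 ≡ q * + 8 - (B - + 3)
          regroup = solve-∀

      two-adic-1,5 : p ≡ 2 → + 8 ∣ B - + 1 ⊎ + 8 ∣ B - + 5 → Outcome
      two-adic-1,5 refl B≡1,5 with k ℕ.<? ℓ
      ... | yes k<ℓ = inj₂ (point-2-k<ℓ hn k ℓ B C p∤C j h ℓ≡ k≡ (h+h<1+j+j⇒h≤j h j (subst₂ _<_ k≡ ℓ≡ k<ℓ)) 4∣B-1)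
        where
        shift : ∀ B → B - + 5 + + 4 ≡ B - + 1
        shift = solve-∀
        4∣B-1 : + 4 ∣ B - + 1
        4∣B-1 = [ 8∣⇒4∣ , (λ 8∣B-5 → ∣-≡ (shift B) (∣m∣n⇒∣m+n (8∣⇒4∣ 8∣B-5) ∣-refl)) ]′ B≡1,5
      ... | no  k≮ℓ with k ℕ.<? (n ℕ.+ ℓ) ∸ 2
      ...   | yes k<n+ℓ-2 = inj₁ (odd-ℓ , case-iv (refl , even-k , ℓ<k k≮ℓ , k<n+ℓ-2 ,
                [ (λ B≡1 → inj₁ (∣⇒∣ᵤ B≡1)) , (λ B≡5 → inj₂ (inj₂ (∣⇒∣ᵤ B≡5))) ]′ B≡1,5))
      ...   | no  k≮n+ℓ-2 = inj₁ (odd-ℓ , case-v (refl , k≡n+ℓ-2 k≮n+ℓ-2 ,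
                [ (λ B≡1 → inj₁ (∣⇒∣ᵤ B≡1)) , (λ B≡5 → inj₂ (∣⇒∣ᵤ B≡5)) ]′ B≡1,5))

      two-adic : p ≡ 2 → Outcome
      two-adic refl with odd-mod8 B p∤B
      ... | inj₁ B≡1               = two-adic-1,5 refl (inj₁ B≡1)
      ... | inj₂ (inj₁ B≡3)        = two-adic-3 refl B≡3
      ... | inj₂ (inj₂ (inj₁ B≡5)) = two-adic-1,5 refl (inj₂ B≡5)
      ... | inj₂ (inj₂ (inj₂ B≡7)) = inj₂ (point-k-even pr hn k ℓ B C p∤B p∤C h 2 f k≡ k+f≡ℓ+2n (hensel-2 _ 8∣a-1))
        where
        regroup : ∀ c B → c - B - + 1 ≡ c - (B - + 7) - + 8
        regroup = solve-∀
        8∣a-1 : + 8 ∣ 2 ↑ f * C - B - + 1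
        8∣a-1 = ∣-≡ (sym (regroup (2 ↑ f * C) B))
          (∣m∣n⇒∣m-n (∣m∣n⇒∣m-n (∣m⇒∣m*n C (↑-monoʳ-∣ 2 {3} {f} (ℕ.≤-trans 3≤n (ℕ.<⇒≤ n<f)))) B≡7) ∣-refl)

    condition⊎point : Condition (suc (hn ℕ.+ hn)) p k ℓ B ⊎ YNonempty (suc (hn ℕ.+ hn)) (p ↑ k * B) (p ↑ ℓ * C) p
    condition⊎point with even⊎odd ℓ
    ... | inj₁ (i , ℓ≡i+i) = inj₂ (point-ℓ-even pr hn k ℓ B C p∤B p∤C i ℓ≡i+i)
    ... | inj₂ (j , ℓ≡) with even⊎odd k
    ...   | inj₂ (i , k≡) = odd-k j ℓ≡ i k≡
    ...   | inj₁ (h , k≡) with k ℕ.<? n ℕ.+ ℓ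
    ...     | no  k≮n+ℓ = inj₂ (k≥n+ℓ j ℓ≡ k≮n+ℓ (point-k≡ℓ+n pr hn k ℓ B C p∤B p∤C))
    ...     | yes k<n+ℓ with p ℕ.≟ 2
    ...       | no  p≢2 = odd-p j ℓ≡ h k≡ k<n+ℓ p≢2
    ...       | yes p≡2 = two-adic j ℓ≡ h k≡ k<n+ℓ p≡2

open Solubility using (odd⇒≡1+j+j; p∤xy⇒p∤x×p∤y; condition⇒no-point; condition⊎point)

open import Data.Nat as ℕ using (ℕ; _^_; _≤_; _<_; _+_; _∸_)
open import Data.Nat.Primality using (Prime)
open import Data.Integer as ℤ using (ℤ; +_; _*_; -_)
open import Data.Integer.Divisibility using (_∣_)
open import Data.Product using (_×_; _,_)
open import Data.Sum using (_⊎_; [_,_]′)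
open import Data.Empty using (⊥-elim)
open import Relation.Binary.PropositionalEquality using (_≡_; _≢_; refl)
open import Relation.Nullary using (¬_)
open import Function using (id)
open import Function.Bundles using (_⇔_; mk⇔)

proposition3p1 :
    (n : ℕ) → 3 ≤ n → Odd n →
    (B C : ℤ) → B ≢ + 0 → C ≢ + 0 →
    (p : ℕ) → Prime p →
    (k ℓ : ℕ) (B′ C′ : ℤ) →
    B ≡ (+ (p ^ k)) * B′ → C ≡ (+ (p ^ ℓ)) * C′ →
    ¬ ((+ p) ∣ (B′ * C′)) →
    ((¬ YNonempty n B C p)
      ⇔ (Odd ℓ ×
          ((Odd k × ℓ < k × k < n + ℓ)
          ⊎ (p ≢ 2 × Even k × k < n + ℓ × LegendreMinusOne (- B′) p)
          ⊎ (p ≡ 2 × Even k × k < ℓ × (B′ ≡ + 3 [mod 8 ]))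
          ⊎ (p ≡ 2 × Even k × ℓ < k × k < (n + ℓ) ∸ 2
              × ((B′ ≡ + 1 [mod 8 ]) ⊎ (B′ ≡ + 3 [mod 8 ]) ⊎ (B′ ≡ + 5 [mod 8 ])))
          ⊎ (p ≡ 2 × k ≡ (n + ℓ) ∸ 2
              × ((B′ ≡ + 1 [mod 8 ]) ⊎ (B′ ≡ + 5 [mod 8 ]))))))
-- B, C ≠ 0 is implied by p ∤ B′C′.
proposition3p1 n 3≤n odd-n B C _ _ p pr k ℓ B′ C′ refl refl p∤B′C′
  with odd⇒≡1+j+j n odd-n | p∤xy⇒p∤x×p∤y pr B′ C′ p∤B′C′
... | hn , refl | p∤B′ , p∤C′ = mk⇔
  (λ no-point → [ id , (λ point → ⊥-elim (no-point point)) ]′ (condition⊎point hn 3≤n pr k ℓ B′ C′ p∤B′ p∤C′))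
  (condition⇒no-point hn 3≤n pr k ℓ B′ C′ p∤B′ p∤C′)
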